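{- Let $n \ge k \ge 2$ be integers. Then \[ \mathbb{P}\big( G \sim \mathbb{G}(n,1/2) \text{ is a } k\text{ -Ramsey graph} \big) = (-1)^{\binom{n}{k}}\, 2^{\left(1-\binom{k}{2}\right)\binom{n}{k}} \cdot Q_{n,k}\!\left(1 - 2^{\binom{k}{2}-1}\right). \]
   Context: $[n]=\{1,\dots,n\}$; $\binom{S}{j}$ is the set of $j$-element subsets of $S$. $\mathbb{G}(n,1/2)$ is the Erdős–Rényi random graph on $[n]$ with edge probability $1/2$. A graph is $k$-Ramsey if it contains no clique of size $k$ and no independent set of size $k$. Let $\mathcal{B}$ be the set of assignments $\mathfrak{h}$ which associate to each $S\in\binom{[n]}{k}$ a finite simple undirected graph $\mathfrak{h}_S$ on vertex set $S$ such that (i) for every $S$, $|\mathbf{E}(\mathfrak{h}_S)|$ is even, and (ii) for every $e\in\binom{[n]}{2}$, the number of $S\in\binom{[n]}{k}$ with $e\in\mathbf{E}(\mathfrak{h}_S)$ is even. For $\mathfrak{h}\in\mathcal{B}$, $\mathrm{Empty}(\mathfrak{h}) := \{S\in\binom{[n]}{k} : \mathfrak{h}_S \text{ has no edges}\}$. Define $Q_{n,k}(t) := \sum_{\mathfrak{h}\in\mathcal{B}} t^{|\mathrm{Empty}(\mathfrak{h})|}\in\mathbb{Z}[t]$. -}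

module Defs where

open import Data.Bool using (Bool; true; false; not; _∧_; _∨_; if_then_else_)
open import Data.Nat using (ℕ; zero; suc; _+_; _∸_; _^_; _<ᵇ_; _≡ᵇ_)
open import Data.Nat.Properties using (m^n≢0)
open import Data.Nat.Combinatorics using (_C_)
open import Data.Fin using (Fin; toℕ)
open import Data.List using (List; []; _∷_; [_]; map; concatMap; length; filterᵇ; lookup; allFin; foldr)
open import Data.Bool.ListAction using (and; or)
open import Data.Vec.Functional using () renaming (_∷_ to _∷ᶠ_)
open import Data.Integer as ℤ using (ℤ; +_)
open import Data.Rational as ℚ using (ℚ)

allFuns : {X : Set} (m : ℕ) → List X → List (Fin m → X)
allFuns zero    xs = [ (λ ()) ]
allFuns (suc m) xs = concatMap (λ x → map (λ f → x ∷ᶠ f) (allFuns m xs)) xs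

bools : List Bool
bools = true ∷ false ∷ []

allᶠ : {m : ℕ} → (Fin m → Bool) → Bool
allᶠ {m} p = and (map p (allFin m))

anyᶠ : {m : ℕ} → (Fin m → Bool) → Bool
anyᶠ {m} p = or (map p (allFin m))

countᶠ : {m : ℕ} → (Fin m → Bool) → ℕ
countᶠ {m} p = length (filterᵇ p (allFin m))

isEven : ℕ → Bool
isEven zero    = true
isEven (suc n) = not (isEven n)

_<ᶠ_ : {m : ℕ} → Fin m → Fin m → Bool
i <ᶠ j = toℕ i <ᵇ toℕ j

Adj : ℕ → Set
Adj n = Fin n → Fin n → Bool

isSimple : {n : ℕ} → Adj n → Bool
isSimple G = allᶠ (λ i → not (G i i)) ∧ allᶠ (λ i → allᶠ (λ j → if G i j then G j i else not (G j i)))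

simpleGraphs : (n : ℕ) → List (Adj n)
simpleGraphs n = filterᵇ isSimple (allFuns n (allFuns n bools))

sumᶠ : {m : ℕ} → (Fin m → ℕ) → ℕ
sumᶠ {m} f = foldr _+_ 0 (map f (allFin m))

edgeCount : {n : ℕ} → Adj n → ℕ
edgeCount G = sumᶠ (λ i → countᶠ (λ j → (i <ᶠ j) ∧ G i j))

Sub : ℕ → Set
Sub n = Fin n → Bool

size : {n : ℕ} → Sub n → ℕ
size S = countᶠ S

kSubsets : (n k : ℕ) → List (Sub n)
kSubsets n k = filterᵇ (λ S → size S ≡ᵇ k) (allFuns n bools)

isCliqueOn : {n : ℕ} → Adj n → Sub n → Bool
isCliqueOn G S = allᶠ (λ i → allᶠ (λ j →
  if (S i ∧ S j ∧ (i <ᶠ j)) then G i j else true))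

isIndepOn : {n : ℕ} → Adj n → Sub n → Bool
isIndepOn G S = allᶠ (λ i → allᶠ (λ j →
  if (S i ∧ S j ∧ (i <ᶠ j)) then not (G i j) else true))

isRamsey : {n : ℕ} → ℕ → Adj n → Bool
isRamsey {n} k G = not (or (map (λ S → isCliqueOn G S ∨ isIndepOn G S) (kSubsets n k)))

-- P(G ~ G(n,1/2) is k-Ramsey) = #{k-Ramsey simple graphs on [n]} / 2^(n choose 2)
ramseyProb : (n k : ℕ) → ℚ
ramseyProb n k =
  ℚ._/_ (+ length (filterᵇ (isRamsey k) (simpleGraphs n))) (2 ^ (n C 2)) ⦃ m^n≢0 2 (n C 2) ⦄

-- An assignment 𝔥 : S ↦ 𝔥_S is encoded as a function on the indices of the
-- list kSubsets n k; 𝔥 a is the graph attached to S = lookup (kSubsets n k) a.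
Assignment : (n k : ℕ) → Set
Assignment n k = Fin (length (kSubsets n k)) → Adj n

graphOn : {n : ℕ} → Sub n → Adj n → Bool
graphOn S H = isSimple H ∧ allᶠ (λ i → allᶠ (λ j → if H i j then S i ∧ S j else true))

inB : (n k : ℕ) → Assignment n k → Bool
inB n k h =
  allᶠ (λ a → graphOn (lookup (kSubsets n k) a) (h a))
  ∧ allᶠ (λ a → isEven (edgeCount (h a)))
  ∧ allᶠ (λ i → allᶠ (λ j → if i <ᶠ j then isEven (countᶠ (λ a → h a i j)) else true))

𝓑 : (n k : ℕ) → List (Assignment n k)
𝓑 n k = filterᵇ (inB n k) (allFuns _ (simpleGraphs n))

emptyCount : {n k : ℕ} → Assignment n k → ℕ
emptyCount h = countᶠ (λ a → edgeCount (h a) ≡ᵇ 0)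

Q : (n k : ℕ) → ℤ → ℤ
Q n k t = foldr ℤ._+_ (+ 0) (map (λ h → t ℤ.^ emptyCount h) (𝓑 n k))

-- Write χ K G = (-1)^|E(K) ∩ E(G)| for the characters of the edge space of
-- K_n.  Orthogonality, ∑_{M ⊆ T} χ K M = 2^|T| · [K ∩ T = ∅], follows by
-- induction on |T|: toggling a fixed edge e of T in M either flips the sign of
-- every term (e ∈ K) or matches the terms containing e with those avoiding it
-- (e ∉ K).
--
-- For a k-set S and c = 2^(C(k,2)-1), orthogonality over the subgraphs of the
-- complete graph on S gives  c · [S is not monochromatic in G] =
-- ∑_H w_S(H) χ H G,  where H ranges over the graphs on S with an even number of
-- edges and w_S(H) = c · [H = ∅] - 1.  Multiplying over all k-sets expresses
-- c^C(n,k) · [G is k-Ramsey] as a product of such sums; expanding it and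
-- summing over G, orthogonality keeps exactly the families 𝔥 that use every
-- edge an even number of times, i.e. 𝔥 ∈ 𝓑, each with weight
-- 2^C(n,2) ∏_S w_S(𝔥_S) = 2^C(n,2) (-1)^C(n,k) (1 - c)^|Empty(𝔥)|.

{-# OPTIONS --safe #-}
module Submission where

open import Defs
open import Data.Bool using (Bool; true; false; not; _∧_; _∨_; _xor_; if_then_else_; T)
open import Data.Bool.Properties using (∧-comm; ∧-assoc; ∧-conicalˡ; ∧-conicalʳ; ∧-zeroʳ; ∧-identityʳ; ∨-zeroʳ; xor-assoc; xor-identityʳ; not-involutive)
open import Data.Bool.ListAction using (and; or)
open import Data.Empty using (⊥; ⊥-elim)
open import Data.Fin using (Fin; zero; suc; toℕ)
open import Data.Fin.Properties using (toℕ-injective; suc-injective) renaming (_≟_ to _≟ᶠ_)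
open import Data.Integer as ℤ using (ℤ; +_; -_; _+_; _-_; -1ℤ) renaming (_*_ to _·_)
import Data.Integer.Properties as ℤₚ
open import Algebra.Properties.CommutativeSemigroup ℤₚ.+-commutativeSemigroup using () renaming (interchange to +-interchange)
open import Algebra.Properties.CommutativeSemigroup ℤₚ.*-commutativeSemigroup using (x∙yz≈y∙xz; x∙yz≈yx∙z; xy∙z≈xz∙y) renaming (interchange to ·-interchange)
open import Data.Integer.Tactic.RingSolver using (solve-∀)
open import Data.List using (List; []; _∷_; _++_; map; concatMap; length; filterᵇ; lookup; foldr; tabulate)
open import Data.Nat as ℕ using (ℕ; zero; suc; _≤_; _^_; _∸_; _*_; s≤s; _≡ᵇ_; _<ᵇ_)
import Data.Nat.Properties as ℕₚ
open import Data.Nat.Properties using (m^n≢0)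
open import Data.Nat.Combinatorics using (_C_; nC1≡n; nCk+nC[k+1]≡[n+1]C[k+1])
open import Data.Product using (_×_; _,_; proj₁; proj₂; ∃)
open import Data.Rational as ℚ using (ℚ; toℚᵘ)
open import Data.Rational.Properties using (toℚᵘ-injective; toℚᵘ-fromℚᵘ; toℚᵘ-homo-*)
open import Data.Rational.Unnormalised as ℚᵘ using (mkℚᵘ; *≡*)
open import Data.Rational.Unnormalised.Properties using (≃-refl; *-cong; module ≃-Reasoning)
open import Data.Sum using (_⊎_; inj₁; inj₂)
open import Data.Unit using (tt)
open import Data.Vec.Functional using () renaming (_∷_ to _∷ᶠ_)
open import Function using (_∘_; id)
open import Relation.Binary.PropositionalEquality
open import Relation.Nullary using (¬_; yes; no)

private
  variable
    A B : Set

⟦_⟧ : Bool → ℤ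
⟦ true  ⟧ = + 1
⟦ false ⟧ = + 0

∑ : List A → (A → ℤ) → ℤ
∑ []       f = + 0
∑ (x ∷ xs) f = f x + ∑ xs f

infixl 10 ∑ ∏
syntax ∑ xs (λ x → e) = ∑[ x ∈ xs ] e

∏ : (m : ℕ) → (Fin m → ℤ) → ℤ
∏ zero    f = + 1
∏ (suc m) f = f zero · ∏ m (f ∘ suc)

syntax ∏ m (λ i → e) = ∏[ i < m ] e

∑-cong : (xs : List A) {f g : A → ℤ} → (∀ x → f x ≡ g x) → ∑ xs f ≡ ∑ xs g
∑-cong []       f≗g = refl
∑-cong (x ∷ xs) f≗g = cong₂ _+_ (f≗g x) (∑-cong xs f≗g)

∑-++ : (xs ys : List A) (f : A → ℤ) → ∑ (xs ++ ys) f ≡ ∑ xs f + ∑ ys f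
∑-++ []       ys f = sym (ℤₚ.+-identityˡ _)
∑-++ (x ∷ xs) ys f = trans (cong (_+_ (f x)) (∑-++ xs ys f)) (sym (ℤₚ.+-assoc (f x) _ _))

∑-distrib-+ : (xs : List A) (f g : A → ℤ) → ∑[ x ∈ xs ] (f x + g x) ≡ ∑ xs f + ∑ xs g
∑-distrib-+ []       f g = refl
∑-distrib-+ (x ∷ xs) f g = trans (cong (_+_ (f x + g x)) (∑-distrib-+ xs f g)) (+-interchange (f x) (g x) _ _)

∑-neg : (xs : List A) (f : A → ℤ) → ∑[ x ∈ xs ] (- f x) ≡ - ∑ xs f
∑-neg []       f = refl
∑-neg (x ∷ xs) f = trans (cong (_+_ (- f x)) (∑-neg xs f)) (sym (ℤₚ.neg-distrib-+ (f x) _))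

∑-distrib-- : (xs : List A) (f g : A → ℤ) → ∑[ x ∈ xs ] (f x - g x) ≡ ∑ xs f - ∑ xs g
∑-distrib-- xs f g = trans (∑-distrib-+ xs f (-_ ∘ g)) (cong (_+_ (∑ xs f)) (∑-neg xs g))

·-distribˡ-∑ : (c : ℤ) (xs : List A) (f : A → ℤ) → c · ∑ xs f ≡ ∑[ x ∈ xs ] (c · f x)
·-distribˡ-∑ c []       f = ℤₚ.*-zeroʳ c
·-distribˡ-∑ c (x ∷ xs) f = trans (ℤₚ.*-distribˡ-+ c (f x) _) (cong (_+_ (c · f x)) (·-distribˡ-∑ c xs f))

·-distribʳ-∑ : (c : ℤ) (xs : List A) (f : A → ℤ) → ∑ xs f · c ≡ ∑[ x ∈ xs ] (f x · c)
·-distribʳ-∑ c xs f = trans (ℤₚ.*-comm _ c) (trans (·-distribˡ-∑ c xs f) (∑-cong xs (λ x → ℤₚ.*-comm c (f x))))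

∑-zero : (xs : List A) → ∑[ x ∈ xs ] (+ 0) ≡ + 0
∑-zero []       = refl
∑-zero (x ∷ xs) = trans (ℤₚ.+-identityˡ _) (∑-zero xs)

∑-comm : (xs : List A) (ys : List B) (f : A → B → ℤ) →
         ∑[ x ∈ xs ] ∑[ y ∈ ys ] f x y ≡ ∑[ y ∈ ys ] ∑[ x ∈ xs ] f x y
∑-comm []       ys f = sym (∑-zero ys)
∑-comm (x ∷ xs) ys f = trans (cong (_+_ (∑ ys (f x))) (∑-comm xs ys f)) (sym (∑-distrib-+ ys (f x) _))

∑-map : (g : A → B) (xs : List A) (f : B → ℤ) → ∑ (map g xs) f ≡ ∑ xs (f ∘ g)
∑-map g []       f = refl
∑-map g (x ∷ xs) f = cong (_+_ (f (g x))) (∑-map g xs f)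

∑-concatMap : (g : A → List B) (xs : List A) (f : B → ℤ) →
              ∑ (concatMap g xs) f ≡ ∑[ x ∈ xs ] ∑ (g x) f
∑-concatMap g []       f = refl
∑-concatMap g (x ∷ xs) f = trans (∑-++ (g x) _ f) (cong (_+_ (∑ (g x) f)) (∑-concatMap g xs f))

∑-filter : (p : A → Bool) (xs : List A) (f : A → ℤ) → ∑ (filterᵇ p xs) f ≡ ∑[ x ∈ xs ] (⟦ p x ⟧ · f x)
∑-filter p []       f = refl
∑-filter p (x ∷ xs) f with p x
... | true  = cong₂ _+_ (sym (ℤₚ.*-identityˡ (f x))) (∑-filter p xs f)
... | false = trans (∑-filter p xs f) (sym (ℤₚ.+-identityˡ _))

∑-filter-cong : (p : A → Bool) (xs : List A) {f g : A → ℤ} →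
                (∀ x → p x ≡ true → f x ≡ g x) → ∑ (filterᵇ p xs) f ≡ ∑ (filterᵇ p xs) g
∑-filter-cong p []       f≗g = refl
∑-filter-cong p (x ∷ xs) f≗g with p x in px
... | true  = cong₂ _+_ (f≗g x px) (∑-filter-cong p xs f≗g)
... | false = ∑-filter-cong p xs f≗g

length-filter : (p : A → Bool) (xs : List A) → + length (filterᵇ p xs) ≡ ∑[ x ∈ xs ] ⟦ p x ⟧
length-filter p []       = refl
length-filter p (x ∷ xs) with p x
... | true  = trans (ℤₚ.pos-+ 1 _) (cong (_+_ (+ 1)) (length-filter p xs))
... | false = trans (length-filter p xs) (sym (ℤₚ.+-identityˡ _))

foldr-map≡∑ : (f : A → ℤ) (xs : List A) → foldr _+_ (+ 0) (map f xs) ≡ ∑ xs f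
foldr-map≡∑ f []       = refl
foldr-map≡∑ f (x ∷ xs) = cong (_+_ (f x)) (foldr-map≡∑ f xs)

∏-cong : ∀ m {f g : Fin m → ℤ} → (∀ i → f i ≡ g i) → ∏ m f ≡ ∏ m g
∏-cong zero    f≗g = refl
∏-cong (suc m) f≗g = cong₂ _·_ (f≗g zero) (∏-cong m (f≗g ∘ suc))

∏-one : ∀ m {f : Fin m → ℤ} → (∀ i → f i ≡ + 1) → ∏ m f ≡ + 1
∏-one zero    f≗1 = refl
∏-one (suc m) f≗1 = cong₂ _·_ (f≗1 zero) (∏-one m (f≗1 ∘ suc))

∏-const : ∀ m (c : ℤ) → ∏[ i < m ] c ≡ c ℤ.^ m
∏-const zero    c = refl
∏-const (suc m) c = cong (c ·_) (∏-const m c)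

∏-distrib-· : ∀ m (f g : Fin m → ℤ) → ∏ m f · ∏ m g ≡ ∏[ i < m ] (f i · g i)
∏-distrib-· zero    f g = refl
∏-distrib-· (suc m) f g =
  trans (·-interchange (f zero) _ (g zero) _) (cong (f zero · g zero ·_) (∏-distrib-· m (f ∘ suc) (g ∘ suc)))

∏-negate-one : ∀ m {f g : Fin m → ℤ} (i : Fin m) → f i ≡ - g i → (∀ j → j ≢ i → f j ≡ g j) → ∏ m f ≡ - ∏ m g
∏-negate-one (suc m) {f} {g} zero    fi≡-gi f≗g =
  trans (cong₂ _·_ fi≡-gi (∏-cong m (λ j → f≗g (suc j) λ ()))) (sym (ℤₚ.neg-distribˡ-* (g zero) _))
∏-negate-one (suc m) {f} {g} (suc i) fi≡-gi f≗g =
  trans (cong₂ _·_ (f≗g zero λ ()) (∏-negate-one m i fi≡-gi (λ j j≢i → f≗g (suc j) (j≢i ∘ suc-injective))))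
        (sym (ℤₚ.neg-distribʳ-* (g zero) _))

⟦not-or⟧ : (p : A → Bool) (xs : List A) → ⟦ not (or (map p xs)) ⟧ ≡ ∏[ a < length xs ] (+ 1 - ⟦ p (lookup xs a) ⟧)
⟦not-or⟧ p []       = refl
⟦not-or⟧ p (x ∷ xs) with p x
... | true  = sym (ℤₚ.*-zeroˡ (∏[ a < length xs ] (+ 1 - ⟦ p (lookup xs a) ⟧)))
... | false = trans (⟦not-or⟧ p xs) (sym (ℤₚ.*-identityˡ _))

lookup-filterᵇ : (p : A → Bool) (xs : List A) (a : Fin (length (filterᵇ p xs))) → p (lookup (filterᵇ p xs) a) ≡ true
lookup-filterᵇ p (x ∷ xs) a with p x in px
lookup-filterᵇ p (x ∷ xs) zero    | true = px
lookup-filterᵇ p (x ∷ xs) (suc a) | true = lookup-filterᵇ p xs a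
... | false = lookup-filterᵇ p xs a

∑-allFuns-suc : ∀ m (xs : List A) (F : (Fin (suc m) → A) → ℤ) →
                ∑ (allFuns (suc m) xs) F ≡ ∑[ x ∈ xs ] ∑[ f ∈ allFuns m xs ] F (x ∷ᶠ f)
∑-allFuns-suc m xs F = trans (∑-concatMap _ xs F) (∑-cong xs (λ x → ∑-map (x ∷ᶠ_) (allFuns m xs) F))

∑-allFuns-∏ : ∀ m (xs : List A) (g : Fin m → A → ℤ) →
              ∑[ f ∈ allFuns m xs ] ∏[ i < m ] g i (f i) ≡ ∏[ i < m ] ∑ xs (g i)
∑-allFuns-∏ zero    xs g = refl
∑-allFuns-∏ (suc m) xs g = begin
  ∑[ f ∈ allFuns (suc m) xs ] ∏[ i < suc m ] g i (f i)
    ≡⟨ ∑-allFuns-suc m xs _ ⟩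
  ∑[ x ∈ xs ] ∑[ f ∈ allFuns m xs ] (g zero x · ∏[ i < m ] g (suc i) (f i))
    ≡⟨ ∑-cong xs (λ x → sym (·-distribˡ-∑ (g zero x) (allFuns m xs) _)) ⟩
  ∑[ x ∈ xs ] (g zero x · ∑[ f ∈ allFuns m xs ] ∏[ i < m ] g (suc i) (f i))
    ≡⟨ ∑-cong xs (λ x → cong (g zero x ·_) (∑-allFuns-∏ m xs (g ∘ suc))) ⟩
  ∑[ x ∈ xs ] (g zero x · ∏[ i < m ] ∑ xs (g (suc i)))
    ≡⟨ sym (·-distribʳ-∑ _ xs (g zero)) ⟩
  ∑ xs (g zero) · ∏[ i < m ] ∑ xs (g (suc i)) ∎
  where open ≡-Reasoning

-- Unlike the pointwise updateAt of Data.Vec.Functional, this reduces to _∷ᶠ_,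
-- which is what lets it commute with the enumeration allFuns.
modifyAt : ∀ {m} → Fin m → (A → A) → (Fin m → A) → (Fin m → A)
modifyAt zero    φ f = φ (f zero) ∷ᶠ (f ∘ suc)
modifyAt (suc i) φ f = f zero ∷ᶠ modifyAt i φ (f ∘ suc)

modifyAt-updates : ∀ {m} (i : Fin m) (φ : A → A) (f : Fin m → A) → modifyAt i φ f i ≡ φ (f i)
modifyAt-updates zero    φ f = refl
modifyAt-updates (suc i) φ f = modifyAt-updates i φ (f ∘ suc)

modifyAt-minimal : ∀ {m} (i j : Fin m) (φ : A → A) (f : Fin m → A) → i ≢ j → modifyAt i φ f j ≡ f j
modifyAt-minimal zero    zero    φ f i≢j = ⊥-elim (i≢j refl)
modifyAt-minimal zero    (suc j) φ f i≢j = refl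
modifyAt-minimal (suc i) zero    φ f i≢j = refl
modifyAt-minimal (suc i) (suc j) φ f i≢j = modifyAt-minimal i j φ (f ∘ suc) (i≢j ∘ cong suc)

∑-allFuns-modifyAt : ∀ m (xs : List A) (φ : A → A) → (∀ G → ∑ xs (G ∘ φ) ≡ ∑ xs G) →
                     ∀ (i : Fin m) F → ∑ (allFuns m xs) (F ∘ modifyAt i φ) ≡ ∑ (allFuns m xs) F
∑-allFuns-modifyAt (suc m) xs φ φ-invariant zero F = begin
  ∑ (allFuns (suc m) xs) (F ∘ modifyAt zero φ)           ≡⟨ ∑-allFuns-suc m xs _ ⟩
  ∑[ x ∈ xs ] ∑[ f ∈ allFuns m xs ] F (φ x ∷ᶠ f)        ≡⟨ φ-invariant (λ y → ∑[ f ∈ allFuns m xs ] F (y ∷ᶠ f)) ⟩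
  ∑[ x ∈ xs ] ∑[ f ∈ allFuns m xs ] F (x ∷ᶠ f)          ≡⟨ sym (∑-allFuns-suc m xs F) ⟩
  ∑ (allFuns (suc m) xs) F                               ∎
  where open ≡-Reasoning
∑-allFuns-modifyAt (suc m) xs φ φ-invariant (suc i) F = begin
  ∑ (allFuns (suc m) xs) (F ∘ modifyAt (suc i) φ)
    ≡⟨ ∑-allFuns-suc m xs _ ⟩
  ∑[ x ∈ xs ] ∑[ f ∈ allFuns m xs ] F (x ∷ᶠ modifyAt i φ f)
    ≡⟨ ∑-cong xs (λ x → ∑-allFuns-modifyAt m xs φ φ-invariant i (F ∘ (x ∷ᶠ_))) ⟩
  ∑[ x ∈ xs ] ∑[ f ∈ allFuns m xs ] F (x ∷ᶠ f)
    ≡⟨ sym (∑-allFuns-suc m xs F) ⟩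
  ∑ (allFuns (suc m) xs) F ∎
  where open ≡-Reasoning

∑-bools-not : (G : Bool → ℤ) → ∑ bools (G ∘ not) ≡ ∑ bools G
∑-bools-not G = swap (G true) (G false)
  where swap : ∀ a b → b + (a + + 0) ≡ a + (b + + 0)
        swap = solve-∀

∧-intro : ∀ {x y} → x ≡ true → y ≡ true → x ∧ y ≡ true
∧-intro refl refl = refl

not≡true : ∀ {x} → not x ≡ true → x ≡ false
not≡true {false} _ = refl

≡false⇒not : ∀ {x} → x ≡ false → not x ≡ true
≡false⇒not refl = refl

true≢false : ∀ {x} → x ≡ true → x ≡ false → ⊥
true≢false refl ()

≡true⇔⇒≡ : ∀ {x y} → (x ≡ true → y ≡ true) → (y ≡ true → x ≡ true) → x ≡ y
≡true⇔⇒≡ {true}  {true}  _ _ = refl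
≡true⇔⇒≡ {true}  {false} f _ = sym (f refl)
≡true⇔⇒≡ {false} {true}  _ g = g refl
≡true⇔⇒≡ {false} {false} _ _ = refl

if-not≡true⇒≡ : ∀ x y → (if x then y else not y) ≡ true → x ≡ y
if-not≡true⇒≡ true  y y≡true  = sym y≡true
if-not≡true⇒≡ false y ny≡true = sym (not≡true ny≡true)

≡⇒if-not≡true : ∀ x y → x ≡ y → (if x then y else not y) ≡ true
≡⇒if-not≡true true  _ refl = refl
≡⇒if-not≡true false _ refl = refl

⟦∧⟧ : ∀ x y → ⟦ x ∧ y ⟧ ≡ ⟦ x ⟧ · ⟦ y ⟧
⟦∧⟧ true  y = sym (ℤₚ.*-identityˡ ⟦ y ⟧)
⟦∧⟧ false y = refl

⟦∨⟧ : ∀ x y → x ∧ y ≡ false → ⟦ x ∨ y ⟧ ≡ ⟦ x ⟧ + ⟦ y ⟧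
⟦∨⟧ true  false _ = refl
⟦∨⟧ false y     _ = sym (ℤₚ.+-identityˡ ⟦ y ⟧)

⟦⟧+⟦not⟧ : ∀ x → ⟦ x ⟧ + ⟦ not x ⟧ ≡ + 1
⟦⟧+⟦not⟧ true  = refl
⟦⟧+⟦not⟧ false = refl

allF : ∀ m → (Fin m → Bool) → Bool
allF zero    p = true
allF (suc m) p = p zero ∧ allF m (p ∘ suc)

b2n : Bool → ℕ
b2n true  = 1
b2n false = 0

countF : ∀ m → (Fin m → Bool) → ℕ
countF zero    p = 0
countF (suc m) p = b2n (p zero) ℕ.+ countF m (p ∘ suc)

sumF : ∀ m → (Fin m → ℕ) → ℕ
sumF zero    f = 0
sumF (suc m) f = f zero ℕ.+ sumF m (f ∘ suc)

xorF : ∀ m → (Fin m → Bool) → Bool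
xorF zero    p = false
xorF (suc m) p = p zero xor xorF m (p ∘ suc)

module _ {m : ℕ} where

  allᶠ≡allF : (p : Fin m → Bool) → allᶠ p ≡ allF m p
  allᶠ≡allF p = go m id
    where go : ∀ l (g : Fin l → Fin m) → and (map p (tabulate g)) ≡ allF l (p ∘ g)
          go zero    g = refl
          go (suc l) g = cong (p (g zero) ∧_) (go l (g ∘ suc))

  countᶠ≡countF : (p : Fin m → Bool) → countᶠ p ≡ countF m p
  countᶠ≡countF p = go m id
    where go : ∀ l (g : Fin l → Fin m) → length (filterᵇ p (tabulate g)) ≡ countF l (p ∘ g)
          go zero    g = refl
          go (suc l) g with p (g zero)
          ... | true  = cong suc (go l (g ∘ suc))
          ... | false = go l (g ∘ suc)

  sumᶠ≡sumF : (f : Fin m → ℕ) → sumᶠ f ≡ sumF m f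
  sumᶠ≡sumF f = go m id
    where go : ∀ l (g : Fin l → Fin m) → foldr ℕ._+_ 0 (map f (tabulate g)) ≡ sumF l (f ∘ g)
          go zero    g = refl
          go (suc l) g = cong (f (g zero) ℕ.+_) (go l (g ∘ suc))

allF-sound : ∀ m {p : Fin m → Bool} → allF m p ≡ true → ∀ i → p i ≡ true
allF-sound (suc m) {p} all zero    = ∧-conicalˡ (p zero) _ all
allF-sound (suc m) {p} all (suc i) = allF-sound m (∧-conicalʳ (p zero) _ all) i

allF-complete : ∀ m {p : Fin m → Bool} → (∀ i → p i ≡ true) → allF m p ≡ true
allF-complete zero    p≗true = refl
allF-complete (suc m) p≗true = ∧-intro (p≗true zero) (allF-complete m (p≗true ∘ suc))

allᶠ-sound : ∀ {m} {p : Fin m → Bool} → allᶠ p ≡ true → ∀ i → p i ≡ true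
allᶠ-sound {m} {p} all = allF-sound m (trans (sym (allᶠ≡allF p)) all)

allᶠ-complete : ∀ {m} {p : Fin m → Bool} → (∀ i → p i ≡ true) → allᶠ p ≡ true
allᶠ-complete {m} {p} p≗true = trans (allᶠ≡allF p) (allF-complete m p≗true)

allF-cong : ∀ m {p q : Fin m → Bool} → (∀ i → p i ≡ q i) → allF m p ≡ allF m q
allF-cong zero    p≗q = refl
allF-cong (suc m) p≗q = cong₂ _∧_ (p≗q zero) (allF-cong m (p≗q ∘ suc))

allF-∧ : ∀ m (p q : Fin m → Bool) → allF m (λ i → p i ∧ q i) ≡ allF m p ∧ allF m q
allF-∧ zero    p q = refl
allF-∧ (suc m) p q = begin
  (p zero ∧ q zero) ∧ allF m (λ i → p (suc i) ∧ q (suc i))   ≡⟨ cong ((p zero ∧ q zero) ∧_) (allF-∧ m (p ∘ suc) (q ∘ suc)) ⟩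
  (p zero ∧ q zero) ∧ (allF m (p ∘ suc) ∧ allF m (q ∘ suc))  ≡⟨ shuffle (p zero) (q zero) _ _ ⟩
  (p zero ∧ allF m (p ∘ suc)) ∧ (q zero ∧ allF m (q ∘ suc))  ∎
  where
    open ≡-Reasoning
    shuffle : ∀ a b c d → (a ∧ b) ∧ (c ∧ d) ≡ (a ∧ c) ∧ (b ∧ d)
    shuffle false b     c d = refl
    shuffle true  true  c d = refl
    shuffle true  false c d = sym (∧-zeroʳ c)

⟦allF⟧ : ∀ m (p : Fin m → Bool) → ⟦ allF m p ⟧ ≡ ∏[ i < m ] ⟦ p i ⟧
⟦allF⟧ zero    p = refl
⟦allF⟧ (suc m) p = trans (⟦∧⟧ (p zero) _) (cong (⟦ p zero ⟧ ·_) (⟦allF⟧ m (p ∘ suc)))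

sgn : Bool → ℤ
sgn true  = -1ℤ
sgn false = + 1

∏-sgn : ∀ m (p : Fin m → Bool) → ∏[ i < m ] sgn (p i) ≡ -1ℤ ℤ.^ countF m p
∏-sgn zero    p = refl
∏-sgn (suc m) p with p zero
... | true  = cong (-1ℤ ·_) (∏-sgn m (p ∘ suc))
... | false = trans (ℤₚ.*-identityˡ _) (∏-sgn m (p ∘ suc))

∏-pow : ∀ m (x : ℤ) (f : Fin m → ℕ) → ∏[ i < m ] (x ℤ.^ f i) ≡ x ℤ.^ sumF m f
∏-pow zero    x f = refl
∏-pow (suc m) x f = trans (cong (x ℤ.^ f zero ·_) (∏-pow m x (f ∘ suc))) (sym (ℤₚ.^-distribˡ-+-* x (f zero) _))

∏-c·⟦p⟧-1 : ∀ m (c : ℤ) (p : Fin m → Bool) → ∏[ a < m ] (c · ⟦ p a ⟧ - + 1) ≡ -1ℤ ℤ.^ m · (+ 1 - c) ℤ.^ countF m p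
∏-c·⟦p⟧-1 zero    c p = refl
∏-c·⟦p⟧-1 (suc m) c p with p zero
... | true  = trans (cong (_·_ (c · + 1 - + 1)) (∏-c·⟦p⟧-1 m c (p ∘ suc))) (regroup c (-1ℤ ℤ.^ m) _)
  where regroup : ∀ c x y → (c · + 1 - + 1) · (x · y) ≡ (-1ℤ · x) · ((+ 1 - c) · y)
        regroup = solve-∀
... | false = trans (cong (_·_ (c · + 0 - + 1)) (∏-c·⟦p⟧-1 m c (p ∘ suc))) (regroup c (-1ℤ ℤ.^ m) _)
  where regroup : ∀ c x y → (c · + 0 - + 1) · (x · y) ≡ (-1ℤ · x) · y
        regroup = solve-∀

-1^≡ : ∀ e → -1ℤ ℤ.^ e ≡ (if isEven e then + 1 else -1ℤ)
-1^≡ zero    = refl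
-1^≡ (suc e) rewrite -1^≡ e with isEven e
... | true  = refl
... | false = refl

2⟦isEven⟧ : ∀ e → + 2 · ⟦ isEven e ⟧ ≡ + 1 + -1ℤ ℤ.^ e
2⟦isEven⟧ e rewrite -1^≡ e with isEven e
... | true  = refl
... | false = refl

+-^ : ∀ a m → (+ a) ℤ.^ m ≡ + (a ^ m)
+-^ a zero    = refl
+-^ a (suc m) = trans (cong (+ a ·_) (+-^ a m)) (sym (ℤₚ.pos-* a (a ^ m)))

/-from-cross-multiplication : ∀ (r a q : ℤ) (d e : ℕ) .{{_ : ℕ.NonZero d}} .{{_ : ℕ.NonZero e}} →
  + d · r ≡ + e · (a · q) → r ℚ./ e ≡ (a ℚ./ 1) ℚ.* (+ 1 ℚ./ d) ℚ.* (q ℚ./ 1)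
/-from-cross-multiplication r a q (suc d) (suc e) cross = toℚᵘ-injective (begin
  toℚᵘ (r ℚ./ suc e)
    ≈⟨ toℚᵘ-fromℚᵘ (mkℚᵘ r e) ⟩
  mkℚᵘ r e
    ≈⟨ *≡* (trans (lhs r (+ suc d)) (trans cross (rhs a q (+ suc e)))) ⟩
  mkℚᵘ a 0 ℚᵘ.* mkℚᵘ (+ 1) d ℚᵘ.* mkℚᵘ q 0
    ≈⟨ *-cong (*-cong (toℚᵘ-fromℚᵘ (mkℚᵘ a 0)) (toℚᵘ-fromℚᵘ (mkℚᵘ (+ 1) d))) (toℚᵘ-fromℚᵘ (mkℚᵘ q 0)) ⟨
  toℚᵘ (a ℚ./ 1) ℚᵘ.* toℚᵘ (+ 1 ℚ./ suc d) ℚᵘ.* toℚᵘ (q ℚ./ 1)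
    ≈⟨ *-cong (toℚᵘ-homo-* (a ℚ./ 1) (+ 1 ℚ./ suc d)) ≃-refl ⟨
  toℚᵘ ((a ℚ./ 1) ℚ.* (+ 1 ℚ./ suc d)) ℚᵘ.* toℚᵘ (q ℚ./ 1)
    ≈⟨ toℚᵘ-homo-* ((a ℚ./ 1) ℚ.* (+ 1 ℚ./ suc d)) (q ℚ./ 1) ⟨
  toℚᵘ ((a ℚ./ 1) ℚ.* (+ 1 ℚ./ suc d) ℚ.* (q ℚ./ 1)) ∎)
  where
    open ≃-Reasoning
    lhs : ∀ r d → r · (+ 1 · d · + 1) ≡ d · r
    lhs = solve-∀
    rhs : ∀ a q e → e · (a · q) ≡ a · + 1 · q · e
    rhs = solve-∀

≡ᵇ0⇒≡0 : ∀ {m} → (m ≡ᵇ 0) ≡ true → m ≡ 0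
≡ᵇ0⇒≡0 {zero}  _  = refl
≡ᵇ0⇒≡0 {suc m} ()

countF-cong : ∀ m {p q : Fin m → Bool} → (∀ i → p i ≡ q i) → countF m p ≡ countF m q
countF-cong zero    p≗q = refl
countF-cong (suc m) p≗q = cong₂ ℕ._+_ (cong b2n (p≗q zero)) (countF-cong m (p≗q ∘ suc))

sumF-cong : ∀ m {f g : Fin m → ℕ} → (∀ i → f i ≡ g i) → sumF m f ≡ sumF m g
sumF-cong zero    f≗g = refl
sumF-cong (suc m) f≗g = cong₂ ℕ._+_ (f≗g zero) (sumF-cong m (f≗g ∘ suc))

isEven-countF : ∀ m (p : Fin m → Bool) → isEven (countF m p) ≡ not (xorF m p)
isEven-countF zero    p = refl
isEven-countF (suc m) p with p zero
... | true  = cong not (isEven-countF m (p ∘ suc))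
... | false = isEven-countF m (p ∘ suc)

countF≡0⇒false : ∀ m {p : Fin m → Bool} → countF m p ≡ 0 → ∀ i → p i ≡ false
countF≡0⇒false (suc m) {p} ≡0 zero    with p zero
... | false = refl
countF≡0⇒false (suc m) {p} ≡0 (suc i) = countF≡0⇒false m (ℕₚ.m+n≡0⇒n≡0 (b2n (p zero)) ≡0) i

false⇒countF≡0 : ∀ m {p : Fin m → Bool} → (∀ i → p i ≡ false) → countF m p ≡ 0
false⇒countF≡0 zero    p≗false = refl
false⇒countF≡0 (suc m) p≗false = cong₂ ℕ._+_ (cong b2n (p≗false zero)) (false⇒countF≡0 m (p≗false ∘ suc))

sumF≡0⇒≡0 : ∀ m {f : Fin m → ℕ} → sumF m f ≡ 0 → ∀ i → f i ≡ 0
sumF≡0⇒≡0 (suc m) {f} ≡0 zero    = ℕₚ.m+n≡0⇒m≡0 (f zero) ≡0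
sumF≡0⇒≡0 (suc m) {f} ≡0 (suc i) = sumF≡0⇒≡0 m (ℕₚ.m+n≡0⇒n≡0 (f zero) ≡0) i

≡0⇒sumF≡0 : ∀ m {f : Fin m → ℕ} → (∀ i → f i ≡ 0) → sumF m f ≡ 0
≡0⇒sumF≡0 zero    f≗0 = refl
≡0⇒sumF≡0 (suc m) f≗0 = cong₂ ℕ._+_ (f≗0 zero) (≡0⇒sumF≡0 m (f≗0 ∘ suc))

countF-nonzero : ∀ m {p : Fin m → Bool} {e} → countF m p ≡ suc e → ∃ λ i → p i ≡ true
countF-nonzero (suc m) {p} ≡suc with p zero in p0
... | true  = zero , p0
... | false = let i , pi = countF-nonzero m ≡suc in suc i , pi

sumF-nonzero : ∀ m {f : Fin m → ℕ} {e} → sumF m f ≡ suc e → ∃ λ i → ∃ λ e′ → f i ≡ suc e′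
sumF-nonzero (suc m) {f} ≡suc with f zero in f0
... | suc e′ = zero , e′ , f0
... | zero   = let i , fi = sumF-nonzero m ≡suc in suc i , fi

countF-increment : ∀ m {p q : Fin m → Bool} (i : Fin m) → p i ≡ true → q i ≡ false →
                   (∀ j → j ≢ i → p j ≡ q j) → countF m p ≡ suc (countF m q)
countF-increment (suc m) zero    pi qi p≗q rewrite pi | qi = cong suc (countF-cong m (λ j → p≗q (suc j) λ ()))
countF-increment (suc m) {p} {q} (suc i) pi qi p≗q rewrite p≗q zero (λ ()) =
  trans (cong (b2n (q zero) ℕ.+_) (countF-increment m i pi qi (λ j j≢i → p≗q (suc j) (j≢i ∘ suc-injective))))
        (ℕₚ.+-suc (b2n (q zero)) _)

sumF-increment : ∀ m {f g : Fin m → ℕ} (i : Fin m) → f i ≡ suc (g i) →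
                 (∀ j → j ≢ i → f j ≡ g j) → sumF m f ≡ suc (sumF m g)
sumF-increment (suc m) {f} {g} zero    fi f≗g rewrite fi = cong (λ s → suc (g zero ℕ.+ s)) (sumF-cong m (λ j → f≗g (suc j) λ ()))
sumF-increment (suc m) {f} {g} (suc i) fi f≗g rewrite f≗g zero (λ ()) =
  trans (cong (g zero ℕ.+_) (sumF-increment m i fi (λ j j≢i → f≗g (suc j) (j≢i ∘ suc-injective))))
        (ℕₚ.+-suc (g zero) _)

<ᵇ-irrefl : ∀ x → (x <ᵇ x) ≡ false
<ᵇ-irrefl zero    = refl
<ᵇ-irrefl (suc x) = <ᵇ-irrefl x

<ᵇ-asym : ∀ x y → (x <ᵇ y) ≡ true → (y <ᵇ x) ≡ false
<ᵇ-asym zero    (suc y) _   = refl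
<ᵇ-asym (suc x) (suc y) x<y = <ᵇ-asym x y x<y

<ᵇ-trichotomy : ∀ x y → (x <ᵇ y) ≡ true ⊎ (y <ᵇ x) ≡ true ⊎ x ≡ y
<ᵇ-trichotomy zero    zero    = inj₂ (inj₂ refl)
<ᵇ-trichotomy zero    (suc y) = inj₁ refl
<ᵇ-trichotomy (suc x) zero    = inj₂ (inj₁ refl)
<ᵇ-trichotomy (suc x) (suc y) with <ᵇ-trichotomy x y
... | inj₁ x<y        = inj₁ x<y
... | inj₂ (inj₁ y<x) = inj₂ (inj₁ y<x)
... | inj₂ (inj₂ x≡y) = inj₂ (inj₂ (cong suc x≡y))

module _ {n : ℕ} where

  <ᶠ-irrefl : (a : Fin n) → a <ᶠ a ≡ false
  <ᶠ-irrefl a = <ᵇ-irrefl (toℕ a)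

  <ᶠ-asym : (a b : Fin n) → a <ᶠ b ≡ true → b <ᶠ a ≡ false
  <ᶠ-asym a b = <ᵇ-asym (toℕ a) (toℕ b)

  <ᶠ⇒≢ : (a b : Fin n) → a <ᶠ b ≡ true → a ≢ b
  <ᶠ⇒≢ a b a<b refl = true≢false a<b (<ᶠ-irrefl a)

  <ᶠ-trichotomy : (a b : Fin n) → a <ᶠ b ≡ true ⊎ b <ᶠ a ≡ true ⊎ a ≡ b
  <ᶠ-trichotomy a b with <ᵇ-trichotomy (toℕ a) (toℕ b)
  ... | inj₁ a<b        = inj₁ a<b
  ... | inj₂ (inj₁ b<a) = inj₂ (inj₁ b<a)
  ... | inj₂ (inj₂ a≡b) = inj₂ (inj₂ (toℕ-injective a≡b))

  record Simple (M : Adj n) : Set where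
    field
      loopless  : ∀ a → M a a ≡ false
      symmetric : ∀ a b → M a b ≡ M b a
  open Simple public

  isSimple⇒Simple : (M : Adj n) → isSimple M ≡ true → Simple M
  isSimple⇒Simple M simple = record
    { loopless  = λ a → not≡true (allᶠ-sound (∧-conicalˡ _ _ simple) a)
    ; symmetric = λ a b → if-not≡true⇒≡ (M a b) (M b a)
                            (allᶠ-sound (allᶠ-sound (∧-conicalʳ _ _ simple) a) b)
    }

  Simple⇒isSimple : (M : Adj n) → Simple M → isSimple M ≡ true
  Simple⇒isSimple M s = ∧-intro
    (allᶠ-complete (λ a → ≡false⇒not (loopless s a)))
    (allᶠ-complete (λ a → allᶠ-complete (λ b → ≡⇒if-not≡true (M a b) (M b a) (symmetric s a b))))

  _⊆_ : Adj n → Adj n → Set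
  M ⊆ T = ∀ a b → M a b ≡ true → T a b ≡ true

  _⊆ᵇ_ : Adj n → Adj n → Bool
  M ⊆ᵇ T = allF n (λ a → allF n (λ b → if M a b then T a b else true))

  ⊆ᵇ-sound : (M T : Adj n) → M ⊆ᵇ T ≡ true → M ⊆ T
  ⊆ᵇ-sound M T M⊆T a b Mab with allF-sound n (allF-sound n M⊆T a) b
  ... | Tab rewrite Mab = Tab

  ⊆ᵇ-complete : (M T : Adj n) → M ⊆ T → M ⊆ᵇ T ≡ true
  ⊆ᵇ-complete M T M⊆T = allF-complete n (λ a → allF-complete n (λ b → entry a b))
    where entry : ∀ a b → (if M a b then T a b else true) ≡ true
          entry a b with M a b in Mab
          ... | true  = M⊆T a b Mab
          ... | false = refl

  Edgeless : Adj n → Set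
  Edgeless P = ∀ a b → a <ᶠ b ≡ true → P a b ≡ false

  edgeless : Adj n → Bool
  edgeless P = allF n (λ a → allF n (λ b → if a <ᶠ b then not (P a b) else true))

  edgeless-sound : (P : Adj n) → edgeless P ≡ true → Edgeless P
  edgeless-sound P empty a b a<b with allF-sound n (allF-sound n empty a) b
  ... | ¬Pab rewrite a<b = not≡true ¬Pab

  edgeless-complete : (P : Adj n) → Edgeless P → edgeless P ≡ true
  edgeless-complete P empty = allF-complete n (λ a → allF-complete n (λ b → entry a b))
    where entry : ∀ a b → (if a <ᶠ b then not (P a b) else true) ≡ true
          entry a b with a <ᶠ b in a<b
          ... | true  = ≡false⇒not (empty a b a<b)
          ... | false = refl

  edgeless-edge : (P : Adj n) (a b : Fin n) → a <ᶠ b ≡ true → P a b ≡ true → edgeless P ≡ false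
  edgeless-edge P a b a<b Pab with edgeless P in empty
  ... | false = refl
  ... | true  = ⊥-elim (true≢false Pab (edgeless-sound P empty a b a<b))

  edgeless-cong : (P Q : Adj n) → (∀ a b → a <ᶠ b ≡ true → P a b ≡ Q a b) → edgeless P ≡ edgeless Q
  edgeless-cong P Q P≗Q = ≡true⇔⇒≡
    (λ e → edgeless-complete Q (λ a b a<b → trans (sym (P≗Q a b a<b)) (edgeless-sound P e a b a<b)))
    (λ e → edgeless-complete P (λ a b a<b → trans (P≗Q a b a<b) (edgeless-sound Q e a b a<b)))

  Simple-Edgeless⇒≡false : (T : Adj n) → Simple T → Edgeless T → ∀ a b → T a b ≡ false
  Simple-Edgeless⇒≡false T s empty a b with <ᶠ-trichotomy a b
  ... | inj₁ a<b        = empty a b a<b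
  ... | inj₂ (inj₁ b<a) = trans (symmetric s a b) (empty b a b<a)
  ... | inj₂ (inj₂ refl) = loopless s a

  _∩_ : Adj n → Adj n → Adj n
  (K ∩ L) a b = K a b ∧ L a b

  _⊕_ : Adj n → Adj n → Adj n
  (K ⊕ L) a b = K a b xor L a b

  allMatrices : List (Adj n)
  allMatrices = allFuns n (allFuns n bools)

  flipEntry : Fin n → Fin n → Adj n → Adj n
  flipEntry i j = modifyAt i (modifyAt j not)

  toggle : Fin n → Fin n → Adj n → Adj n
  toggle i j = flipEntry j i ∘ flipEntry i j

  ∑-flipEntry : ∀ i j (F : Adj n → ℤ) → ∑ allMatrices (F ∘ flipEntry i j) ≡ ∑ allMatrices F
  ∑-flipEntry i j = ∑-allFuns-modifyAt n _ _ (λ G → ∑-allFuns-modifyAt n bools not ∑-bools-not j G) i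

  ∑-toggle : ∀ i j (F : Adj n → ℤ) → ∑ allMatrices (F ∘ toggle i j) ≡ ∑ allMatrices F
  ∑-toggle i j F = trans (∑-flipEntry i j (F ∘ flipEntry j i)) (∑-flipEntry j i F)

  flipEntry-updates : ∀ i j M → flipEntry i j M i j ≡ not (M i j)
  flipEntry-updates i j M =
    trans (cong (λ row → row j) (modifyAt-updates i (modifyAt j not) M)) (modifyAt-updates j not (M i))

  flipEntry-minimal : ∀ i j M a b → ¬ (a ≡ i × b ≡ j) → flipEntry i j M a b ≡ M a b
  flipEntry-minimal i j M a b ¬ij with a ≟ᶠ i
  ... | no a≢i   = cong (λ row → row b) (modifyAt-minimal i a _ M (a≢i ∘ sym))
  ... | yes refl with b ≟ᶠ j
  ...   | yes refl = ⊥-elim (¬ij (refl , refl))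
  ...   | no b≢j   = trans (cong (λ row → row b) (modifyAt-updates a (modifyAt j not) M))
                           (modifyAt-minimal j b not (M a) (b≢j ∘ sym))

  record Toggled (i j : Fin n) (M M′ : Adj n) : Set where
    field
      flips-ij : M′ i j ≡ not (M i j)
      flips-ji : M′ j i ≡ not (M j i)
      keeps    : ∀ a b → ¬ (a ≡ i × b ≡ j) → ¬ (a ≡ j × b ≡ i) → M′ a b ≡ M a b
  open Toggled public

  toggle-Toggled : ∀ i j M → i ≢ j → Toggled i j M (toggle i j M)
  toggle-Toggled i j M i≢j = record
    { flips-ij = trans (flipEntry-minimal j i _ i j (i≢j ∘ proj₁)) (flipEntry-updates i j M)
    ; flips-ji = trans (flipEntry-updates j i _) (cong not (flipEntry-minimal i j M j i (i≢j ∘ sym ∘ proj₁)))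
    ; keeps    = λ a b ¬ij ¬ji → trans (flipEntry-minimal j i _ a b ¬ji) (flipEntry-minimal i j M a b ¬ij)
    }

  Toggled-sym : ∀ {i j M M′} → Toggled i j M M′ → Toggled i j M′ M
  Toggled-sym {i} {j} {M} t = record
    { flips-ij = trans (sym (not-involutive (M i j))) (cong not (sym (flips-ij t)))
    ; flips-ji = trans (sym (not-involutive (M j i))) (cong not (sym (flips-ji t)))
    ; keeps    = λ a b ¬ij ¬ji → sym (keeps t a b ¬ij ¬ji)
    }

  data Cell (i j a b : Fin n) : Set where
    at-ij     : a ≡ i → b ≡ j → Cell i j a b
    at-ji     : a ≡ j → b ≡ i → Cell i j a b
    elsewhere : ¬ (a ≡ i × b ≡ j) → ¬ (a ≡ j × b ≡ i) → Cell i j a b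

  cell : ∀ i j a b → Cell i j a b
  cell i j a b with a ≟ᶠ i | b ≟ᶠ j | a ≟ᶠ j | b ≟ᶠ i
  ... | yes a≡i | yes b≡j | _       | _       = at-ij a≡i b≡j
  ... | _       | _       | yes a≡j | yes b≡i = at-ji a≡j b≡i
  ... | yes _   | no b≢j  | no a≢j  | _       = elsewhere (b≢j ∘ proj₂) (a≢j ∘ proj₁)
  ... | yes _   | no b≢j  | yes _   | no b≢i  = elsewhere (b≢j ∘ proj₂) (b≢i ∘ proj₂)
  ... | no a≢i  | _       | no a≢j  | _       = elsewhere (a≢i ∘ proj₁) (a≢j ∘ proj₁)
  ... | no a≢i  | _       | yes _   | no b≢i  = elsewhere (a≢i ∘ proj₁) (b≢i ∘ proj₂)

  Toggled-Simple : ∀ {i j M M′} → i ≢ j → Toggled i j M M′ → Simple M → Simple M′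
  Toggled-Simple {i} {j} {M} {M′} i≢j t s = record { loopless = loopless′ ; symmetric = symmetric′ }
    where
      loopless′ : ∀ a → M′ a a ≡ false
      loopless′ a with cell i j a a
      ... | at-ij refl refl = ⊥-elim (i≢j refl)
      ... | at-ji refl refl = ⊥-elim (i≢j refl)
      ... | elsewhere ¬ij ¬ji = trans (keeps t a a ¬ij ¬ji) (loopless s a)
      symmetric′ : ∀ a b → M′ a b ≡ M′ b a
      symmetric′ a b with cell i j a b
      ... | at-ij refl refl = trans (flips-ij t) (trans (cong not (symmetric s i j)) (sym (flips-ji t)))
      ... | at-ji refl refl = trans (flips-ji t) (trans (cong not (symmetric s j i)) (sym (flips-ij t)))
      ... | elsewhere ¬ij ¬ji =
        trans (keeps t a b ¬ij ¬ji) (trans (symmetric s a b)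
              (sym (keeps t b a (λ (b≡i , a≡j) → ¬ji (a≡j , b≡i)) (λ (b≡j , a≡i) → ¬ij (a≡i , b≡j)))))

  isSimple-Toggled : ∀ {i j M M′} → i ≢ j → Toggled i j M M′ → isSimple M′ ≡ isSimple M
  isSimple-Toggled {M = M} {M′} i≢j t = ≡true⇔⇒≡
    (λ s → Simple⇒isSimple M (Toggled-Simple i≢j (Toggled-sym t) (isSimple⇒Simple M′ s)))
    (λ s → Simple⇒isSimple M′ (Toggled-Simple i≢j t (isSimple⇒Simple M s)))

  Toggled-⊆ : ∀ {i j M M′} (T : Adj n) → T i j ≡ true → T j i ≡ true → Toggled i j M M′ → M ⊆ T → M′ ⊆ T
  Toggled-⊆ {i} {j} T Tij Tji t M⊆T a b M′ab with cell i j a b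
  ... | at-ij refl refl   = Tij
  ... | at-ji refl refl   = Tji
  ... | elsewhere ¬ij ¬ji = M⊆T a b (trans (sym (keeps t a b ¬ij ¬ji)) M′ab)

  ⊆ᵇ-Toggled : ∀ {i j M M′} (T : Adj n) → T i j ≡ true → T j i ≡ true → Toggled i j M M′ → M′ ⊆ᵇ T ≡ M ⊆ᵇ T
  ⊆ᵇ-Toggled {M = M} {M′} T Tij Tji t = ≡true⇔⇒≡
    (λ M′⊆T → ⊆ᵇ-complete M T (Toggled-⊆ T Tij Tji (Toggled-sym t) (⊆ᵇ-sound M′ T M′⊆T)))
    (λ M⊆T → ⊆ᵇ-complete M′ T (Toggled-⊆ T Tij Tji t (⊆ᵇ-sound M T M⊆T)))

  edgeCount≡sumF : (T : Adj n) → edgeCount T ≡ sumF n (λ a → countF n (λ b → a <ᶠ b ∧ T a b))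
  edgeCount≡sumF T = trans (sumᶠ≡sumF {n} _) (sumF-cong n (λ a → countᶠ≡countF {n} (λ b → a <ᶠ b ∧ T a b)))

  edgeCount≡0⇒Edgeless : (T : Adj n) → edgeCount T ≡ 0 → Edgeless T
  edgeCount≡0⇒Edgeless T ≡0 a b a<b with T a b in Tab
  ... | false = refl
  ... | true  = ⊥-elim (true≢false (∧-intro a<b Tab)
                  (countF≡0⇒false n (sumF≡0⇒≡0 n (trans (sym (edgeCount≡sumF T)) ≡0) a) b))

  Edgeless⇒edgeCount≡0 : (T : Adj n) → Edgeless T → edgeCount T ≡ 0
  Edgeless⇒edgeCount≡0 T empty = trans (edgeCount≡sumF T)
    (≡0⇒sumF≡0 n (λ a → false⇒countF≡0 n (λ b → entry a b)))
    where entry : ∀ a b → a <ᶠ b ∧ T a b ≡ false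
          entry a b with a <ᶠ b in a<b
          ... | true  = empty a b a<b
          ... | false = refl

  edgeCount≡suc⇒edge : (T : Adj n) {e : ℕ} → edgeCount T ≡ suc e → ∃ λ i → ∃ λ j → i <ᶠ j ≡ true × T i j ≡ true
  edgeCount≡suc⇒edge T ≡suc =
    let i , _ , rowᵢ = sumF-nonzero n (trans (sym (edgeCount≡sumF T)) ≡suc)
        j , i<j∧Tij  = countF-nonzero n rowᵢ
    in  i , j , ∧-conicalˡ _ _ i<j∧Tij , ∧-conicalʳ _ _ i<j∧Tij

  edgeCount-Toggled : ∀ {i j} (T T′ : Adj n) → i <ᶠ j ≡ true → T i j ≡ true → Toggled i j T T′ →
                      edgeCount T ≡ suc (edgeCount T′)
  edgeCount-Toggled {i} {j} T T′ i<j Tij t = begin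
    edgeCount T                                               ≡⟨ edgeCount≡sumF T ⟩
    sumF n (λ a → countF n (λ b → a <ᶠ b ∧ T a b))            ≡⟨ sumF-increment n i row-i other-rows ⟩
    suc (sumF n (λ a → countF n (λ b → a <ᶠ b ∧ T′ a b)))     ≡⟨ cong suc (edgeCount≡sumF T′) ⟨
    suc (edgeCount T′)                                        ∎
    where
      open ≡-Reasoning
      entry : ∀ a b → ¬ (a ≡ i × b ≡ j) → a <ᶠ b ∧ T a b ≡ a <ᶠ b ∧ T′ a b
      entry a b ¬ij with cell i j a b
      ... | at-ij a≡i b≡j     = ⊥-elim (¬ij (a≡i , b≡j))
      ... | at-ji refl refl   rewrite <ᶠ-asym i j i<j = refl
      ... | elsewhere ¬ij ¬ji = cong (a <ᶠ b ∧_) (sym (keeps t a b ¬ij ¬ji))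
      T′ij : i <ᶠ j ∧ T′ i j ≡ false
      T′ij rewrite i<j | flips-ij t | Tij = refl
      row-i : countF n (λ b → i <ᶠ b ∧ T i b) ≡ suc (countF n (λ b → i <ᶠ b ∧ T′ i b))
      row-i = countF-increment n j (∧-intro i<j Tij) T′ij (λ b b≢j → entry i b (b≢j ∘ proj₂))
      other-rows : ∀ a → a ≢ i → countF n (λ b → a <ᶠ b ∧ T a b) ≡ countF n (λ b → a <ᶠ b ∧ T′ a b)
      other-rows a a≢i = countF-cong n (λ b → entry a b (a≢i ∘ proj₁))

  χ : Adj n → Adj n → ℤ
  χ K M = ∏[ a < n ] ∏[ b < n ] sgn (a <ᶠ b ∧ (K a b ∧ M a b))

  χ-comm : ∀ K M → χ K M ≡ χ M K
  χ-comm K M = ∏-cong n (λ a → ∏-cong n (λ b → cong (λ x → sgn (a <ᶠ b ∧ x)) (∧-comm (K a b) (M a b))))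

  χ-⊕ : ∀ K L M → χ K M · χ L M ≡ χ (K ⊕ L) M
  χ-⊕ K L M = trans (∏-distrib-· n _ _) (∏-cong n λ a → trans (∏-distrib-· n _ _)
                (∏-cong n λ b → sgn-xor (a <ᶠ b) (K a b) (L a b) (M a b)))
    where sgn-xor : ∀ p k l m → sgn (p ∧ (k ∧ m)) · sgn (p ∧ (l ∧ m)) ≡ sgn (p ∧ ((k xor l) ∧ m))
          sgn-xor false _     _     _     = refl
          sgn-xor true  false false _     = refl
          sgn-xor true  false true  false = refl
          sgn-xor true  false true  true  = refl
          sgn-xor true  true  false false = refl
          sgn-xor true  true  false true  = refl
          sgn-xor true  true  true  false = refl
          sgn-xor true  true  true  true  = refl

  χ-disjoint : ∀ K M → Edgeless (K ∩ M) → χ K M ≡ + 1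
  χ-disjoint K M disjoint = ∏-one n (λ a → ∏-one n (λ b → entry a b))
    where entry : ∀ a b → sgn (a <ᶠ b ∧ (K a b ∧ M a b)) ≡ + 1
          entry a b with a <ᶠ b in a<b
          ... | false = refl
          ... | true rewrite disjoint a b a<b = refl

  module _ {i j : Fin n} {M M′ : Adj n} (K : Adj n) (i<j : i <ᶠ j ≡ true) (t : Toggled i j M M′) where

    private
      entry-off-ij : ∀ a b → ¬ (a ≡ i × b ≡ j) →
                     sgn (a <ᶠ b ∧ (K a b ∧ M′ a b)) ≡ sgn (a <ᶠ b ∧ (K a b ∧ M a b))
      entry-off-ij a b ¬ij with cell i j a b
      ... | at-ij a≡i b≡j     = ⊥-elim (¬ij (a≡i , b≡j))
      ... | at-ji refl refl   rewrite <ᶠ-asym i j i<j = refl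
      ... | elsewhere ¬ij ¬ji = cong (λ x → sgn (a <ᶠ b ∧ (K a b ∧ x))) (keeps t a b ¬ij ¬ji)

    χ-Toggled-flip : K i j ≡ true → χ K M′ ≡ - χ K M
    χ-Toggled-flip Kij = ∏-negate-one n i row-i other-rows
      where
        row-i : ∏[ b < n ] sgn (i <ᶠ b ∧ (K i b ∧ M′ i b)) ≡ - ∏[ b < n ] sgn (i <ᶠ b ∧ (K i b ∧ M i b))
        row-i = ∏-negate-one n j entry-ij (λ b b≢j → entry-off-ij i b (b≢j ∘ proj₂))
          where entry-ij : sgn (i <ᶠ j ∧ (K i j ∧ M′ i j)) ≡ - sgn (i <ᶠ j ∧ (K i j ∧ M i j))
                entry-ij rewrite i<j | Kij | flips-ij t with M i j
                ... | true  = refl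
                ... | false = refl
        other-rows : ∀ a → a ≢ i → ∏[ b < n ] sgn (a <ᶠ b ∧ (K a b ∧ M′ a b)) ≡ ∏[ b < n ] sgn (a <ᶠ b ∧ (K a b ∧ M a b))
        other-rows a a≢i = ∏-cong n (λ b → entry-off-ij a b (a≢i ∘ proj₁))

    χ-Toggled-same : K i j ≡ false → χ K M′ ≡ χ K M
    χ-Toggled-same Kij = ∏-cong n (λ a → ∏-cong n (λ b → entry a b))
      where entry : ∀ a b → sgn (a <ᶠ b ∧ (K a b ∧ M′ a b)) ≡ sgn (a <ᶠ b ∧ (K a b ∧ M a b))
            entry a b with cell i j a b
            ... | at-ij refl refl rewrite Kij | i<j = refl
            ... | at-ji a≡j b≡i = entry-off-ij a b (λ (a≡i , _) → <ᶠ⇒≢ i j i<j (trans (sym a≡i) a≡j))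
            ... | elsewhere ¬ij _ = entry-off-ij a b ¬ij

  -- Summing over all matrices rather than over simpleGraphs n makes toggling an entry a
  -- bijection of the index list; simplicity is imposed by the indicator instead.
  χ-restricted : Adj n → Adj n → Adj n → ℤ
  χ-restricted T K M = ⟦ isSimple M ∧ M ⊆ᵇ T ⟧ · χ K M

  isZero : Adj n → Bool
  isZero M = allF n (λ a → allF n (λ b → not (M a b)))

  isZero-sound : ∀ {M} → isZero M ≡ true → ∀ a b → M a b ≡ false
  isZero-sound M≡0 a b = not≡true (allF-sound n (allF-sound n M≡0 a) b)

  ∑-isZero : ∑[ M ∈ allMatrices ] ⟦ isZero M ⟧ ≡ + 1
  ∑-isZero = begin
    ∑[ M ∈ allMatrices ] ⟦ isZero M ⟧
      ≡⟨ ∑-cong allMatrices (λ M → ⟦allF⟧ n _) ⟩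
    ∑[ M ∈ allMatrices ] ∏[ a < n ] ⟦ allF n (λ b → not (M a b)) ⟧
      ≡⟨ ∑-allFuns-∏ n _ (λ _ row → ⟦ allF n (λ b → not (row b)) ⟧) ⟩
    ∏[ a < n ] ∑[ row ∈ allFuns n bools ] ⟦ allF n (λ b → not (row b)) ⟧
      ≡⟨ ∏-one n (λ _ → trans (∑-cong (allFuns n bools) (λ row → ⟦allF⟧ n _))
                        (trans (∑-allFuns-∏ n bools (λ _ x → ⟦ not x ⟧)) (∏-one n (λ _ → refl)))) ⟩
    + 1 ∎
    where open ≡-Reasoning

  ∑-χ-restricted-edgeless : (T : Adj n) → Simple T → Edgeless T → ∀ K → ∑ allMatrices (χ-restricted T K) ≡ + 1
  ∑-χ-restricted-edgeless T simpleT emptyT K = trans (∑-cong allMatrices summand) ∑-isZero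
    where
      T≡false : ∀ a b → T a b ≡ false
      T≡false = Simple-Edgeless⇒≡false T simpleT emptyT
      zero-simple : ∀ M → isZero M ≡ true → Simple M
      zero-simple M M≡0 = record
        { loopless  = λ a → isZero-sound M≡0 a a
        ; symmetric = λ a b → trans (isZero-sound M≡0 a b) (sym (isZero-sound M≡0 b a))
        }
      subgraph≡zero : ∀ M → isSimple M ∧ M ⊆ᵇ T ≡ isZero M
      subgraph≡zero M = ≡true⇔⇒≡
        (λ M⊆T → allF-complete n λ a → allF-complete n λ b → ≡false⇒not (entry a b (⊆ᵇ-sound M T (∧-conicalʳ _ _ M⊆T))))
        (λ M≡0 → ∧-intro (Simple⇒isSimple M (zero-simple M M≡0))
                          (⊆ᵇ-complete M T (λ a b Mab → ⊥-elim (true≢false Mab (isZero-sound M≡0 a b)))))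
        where entry : ∀ a b → M ⊆ T → M a b ≡ false
              entry a b M⊆T with M a b in Mab
              ... | false = refl
              ... | true  = ⊥-elim (true≢false (M⊆T a b Mab) (T≡false a b))
      summand : ∀ M → χ-restricted T K M ≡ ⟦ isZero M ⟧
      summand M rewrite subgraph≡zero M with isZero M in M≡0
      ... | false = refl
      ... | true  = trans (ℤₚ.*-identityˡ _) (χ-disjoint K M (λ a b _ →
                      trans (cong (K a b ∧_) (isZero-sound M≡0 a b)) (∧-zeroʳ (K a b))))

  module _ {i j : Fin n} (T K : Adj n) (simpleT : Simple T) (i<j : i <ᶠ j ≡ true) (Tij : T i j ≡ true) where

    private
      i≢j : i ≢ j
      i≢j = <ᶠ⇒≢ i j i<j
      Tji : T j i ≡ true
      Tji = trans (symmetric simpleT j i) Tij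

      isSimpleSubgraph-toggle : ∀ M → isSimple (toggle i j M) ∧ toggle i j M ⊆ᵇ T ≡ isSimple M ∧ M ⊆ᵇ T
      isSimpleSubgraph-toggle M = cong₂ _∧_ (isSimple-Toggled i≢j t) (⊆ᵇ-Toggled T Tij Tji t)
        where t : Toggled i j M (toggle i j M)
              t = toggle-Toggled i j M i≢j

    ∑-χ-restricted-vanishes : K i j ≡ true → ∑ allMatrices (χ-restricted T K) ≡ + 0
    ∑-χ-restricted-vanishes Kij = x≡-x⇒x≡0 (begin
      ∑ allMatrices (χ-restricted T K)                  ≡⟨ ∑-toggle i j _ ⟨
      ∑ allMatrices (χ-restricted T K ∘ toggle i j)     ≡⟨ ∑-cong allMatrices flips ⟩
      ∑[ M ∈ allMatrices ] (- χ-restricted T K M)       ≡⟨ ∑-neg allMatrices _ ⟩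
      - ∑ allMatrices (χ-restricted T K)                ∎)
      where
        open ≡-Reasoning
        flips : ∀ M → χ-restricted T K (toggle i j M) ≡ - χ-restricted T K M
        flips M = trans (cong₂ _·_ (cong ⟦_⟧ (isSimpleSubgraph-toggle M)) (χ-Toggled-flip K i<j (toggle-Toggled i j M i≢j) Kij))
                        (sym (ℤₚ.neg-distribʳ-* ⟦ isSimple M ∧ M ⊆ᵇ T ⟧ (χ K M)))
        x≡-x⇒x≡0 : ∀ {x} → x ≡ - x → x ≡ + 0
        x≡-x⇒x≡0 {x} x≡-x = ℤₚ.*-cancelˡ-≡ (+ 2) x (+ 0)
          (trans (two-x x) (trans (cong (_+_ x) x≡-x) (ℤₚ.+-inverseʳ x)))
          where two-x : ∀ x → + 2 · x ≡ x + x
                two-x = solve-∀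

    private
      T′ : Adj n
      T′ = toggle i j T
      tT : Toggled i j T T′
      tT = toggle-Toggled i j T i≢j

      ⊆-without-ij : ∀ M → Simple M → M ⊆ T → M i j ≡ false → M ⊆ T′
      ⊆-without-ij M simpleM M⊆T Mij a b Mab with cell i j a b
      ... | at-ij refl refl   = ⊥-elim (true≢false Mab Mij)
      ... | at-ji refl refl   = ⊥-elim (true≢false (trans (symmetric simpleM i j) Mab) Mij)
      ... | elsewhere ¬ij ¬ji = trans (keeps tT a b ¬ij ¬ji) (M⊆T a b Mab)

      ⊆-with-ij : ∀ M → M ⊆ T′ → M ⊆ T
      ⊆-with-ij M M⊆T′ a b Mab with cell i j a b
      ... | at-ij refl refl   = Tij
      ... | at-ji refl refl   = Tji
      ... | elsewhere ¬ij ¬ji = trans (sym (keeps tT a b ¬ij ¬ji)) (M⊆T′ a b Mab)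

      ⊆-avoids-ij : ∀ M → M ⊆ T′ → M i j ≡ false
      ⊆-avoids-ij M M⊆T′ with M i j in Mij
      ... | false = refl
      ... | true  = ⊥-elim (true≢false (M⊆T′ i j Mij) (trans (flips-ij tT) (cong not Tij)))

      isSimpleSubgraph-without-ij : ∀ M → (isSimple M ∧ M ⊆ᵇ T) ∧ not (M i j) ≡ isSimple M ∧ M ⊆ᵇ T′
      isSimpleSubgraph-without-ij M = ≡true⇔⇒≡ to from
        where
          to : (isSimple M ∧ M ⊆ᵇ T) ∧ not (M i j) ≡ true → isSimple M ∧ M ⊆ᵇ T′ ≡ true
          to e = ∧-intro s (⊆ᵇ-complete M T′ (⊆-without-ij M (isSimple⇒Simple M s) M⊆T (not≡true ¬Mij)))
            where
              s∧M⊆T : isSimple M ∧ M ⊆ᵇ T ≡ true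
              s∧M⊆T = ∧-conicalˡ (isSimple M ∧ M ⊆ᵇ T) (not (M i j)) e
              ¬Mij : not (M i j) ≡ true
              ¬Mij = ∧-conicalʳ (isSimple M ∧ M ⊆ᵇ T) (not (M i j)) e
              s : isSimple M ≡ true
              s = ∧-conicalˡ (isSimple M) (M ⊆ᵇ T) s∧M⊆T
              M⊆T : M ⊆ T
              M⊆T = ⊆ᵇ-sound M T (∧-conicalʳ (isSimple M) (M ⊆ᵇ T) s∧M⊆T)
          from : isSimple M ∧ M ⊆ᵇ T′ ≡ true → (isSimple M ∧ M ⊆ᵇ T) ∧ not (M i j) ≡ true
          from e = ∧-intro (∧-intro s (⊆ᵇ-complete M T (⊆-with-ij M M⊆T′))) (≡false⇒not (⊆-avoids-ij M M⊆T′))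
            where
              s : isSimple M ≡ true
              s = ∧-conicalˡ (isSimple M) (M ⊆ᵇ T′) e
              M⊆T′ : M ⊆ T′
              M⊆T′ = ⊆ᵇ-sound M T′ (∧-conicalʳ (isSimple M) (M ⊆ᵇ T′) e)

    -- Splitting the sum by the entry ij, toggling matches the half with that entry
    -- present to the half without it, and the latter is the sum for T minus ij.
    ∑-χ-restricted-halve : K i j ≡ false →
                           ∑ allMatrices (χ-restricted T K) ≡ + 2 · ∑ allMatrices (χ-restricted T′ K)
    ∑-χ-restricted-halve Kij = begin
      ∑ allMatrices f
        ≡⟨ ∑-cong allMatrices (λ M → split (f M) (M i j)) ⟩
      ∑[ M ∈ allMatrices ] (f M · ⟦ M i j ⟧ + f M · ⟦ not (M i j) ⟧)
        ≡⟨ ∑-distrib-+ allMatrices _ _ ⟩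
      ∑[ M ∈ allMatrices ] (f M · ⟦ M i j ⟧) + ∑[ M ∈ allMatrices ] (f M · ⟦ not (M i j) ⟧)
        ≡⟨ cong (_+ ∑[ M ∈ allMatrices ] (f M · ⟦ not (M i j) ⟧)) (trans (sym (∑-toggle i j _)) (∑-cong allMatrices toggle-ij)) ⟩
      ∑[ M ∈ allMatrices ] (f M · ⟦ not (M i j) ⟧) + ∑[ M ∈ allMatrices ] (f M · ⟦ not (M i j) ⟧)
        ≡⟨ x+x≡2x _ ⟩
      + 2 · ∑[ M ∈ allMatrices ] (f M · ⟦ not (M i j) ⟧)
        ≡⟨ cong (+ 2 ·_) (∑-cong allMatrices remove-ij) ⟩
      + 2 · ∑ allMatrices (χ-restricted T′ K) ∎
      where
        open ≡-Reasoning
        f : Adj n → ℤ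
        f = χ-restricted T K
        split : ∀ x b → x ≡ x · ⟦ b ⟧ + x · ⟦ not b ⟧
        split x b = trans (sym (ℤₚ.*-identityʳ x)) (trans (cong (x ·_) (sym (⟦⟧+⟦not⟧ b))) (ℤₚ.*-distribˡ-+ x _ _))
        x+x≡2x : ∀ x → x + x ≡ + 2 · x
        x+x≡2x = solve-∀
        toggle-ij : ∀ M → f (toggle i j M) · ⟦ toggle i j M i j ⟧ ≡ f M · ⟦ not (M i j) ⟧
        toggle-ij M = cong₂ (λ x y → x · ⟦ y ⟧)
          (cong₂ _·_ (cong ⟦_⟧ (isSimpleSubgraph-toggle M)) (χ-Toggled-same K i<j t Kij)) (flips-ij t)
          where t : Toggled i j M (toggle i j M)
                t = toggle-Toggled i j M i≢j
        remove-ij : ∀ M → f M · ⟦ not (M i j) ⟧ ≡ χ-restricted T′ K M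
        remove-ij M = begin
          ⟦ isSimple M ∧ M ⊆ᵇ T ⟧ · χ K M · ⟦ not (M i j) ⟧
            ≡⟨ xy∙z≈xz∙y ⟦ isSimple M ∧ M ⊆ᵇ T ⟧ (χ K M) _ ⟩
          ⟦ isSimple M ∧ M ⊆ᵇ T ⟧ · ⟦ not (M i j) ⟧ · χ K M
            ≡⟨ cong (_· χ K M) (⟦∧⟧ (isSimple M ∧ M ⊆ᵇ T) (not (M i j))) ⟨
          ⟦ (isSimple M ∧ M ⊆ᵇ T) ∧ not (M i j) ⟧ · χ K M
            ≡⟨ cong (λ b → ⟦ b ⟧ · χ K M) (isSimpleSubgraph-without-ij M) ⟩
          ⟦ isSimple M ∧ M ⊆ᵇ T′ ⟧ · χ K M ∎

  ∑-χ-restricted : ∀ e (T : Adj n) → Simple T → edgeCount T ≡ e → ∀ K →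
                   ∑ allMatrices (χ-restricted T K) ≡ + (2 ^ e) · ⟦ edgeless (K ∩ T) ⟧
  ∑-χ-restricted zero T simpleT ≡0 K =
    trans (∑-χ-restricted-edgeless T simpleT emptyT K) (cong (λ b → + 1 · ⟦ b ⟧) (sym (edgeless-complete (K ∩ T) disjoint)))
    where
      emptyT : Edgeless T
      emptyT = edgeCount≡0⇒Edgeless T ≡0
      disjoint : Edgeless (K ∩ T)
      disjoint a b _ = trans (cong (K a b ∧_) (Simple-Edgeless⇒≡false T simpleT emptyT a b)) (∧-zeroʳ (K a b))
  ∑-χ-restricted (suc e) T simpleT ≡suc K with edgeCount≡suc⇒edge T ≡suc
  ... | i , j , i<j , Tij with K i j in Kij
  ...   | true  rewrite edgeless-edge (K ∩ T) i j i<j (∧-intro Kij Tij) | ℤₚ.*-zeroʳ (+ (2 ^ suc e))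
                = ∑-χ-restricted-vanishes T K simpleT i<j Tij Kij
  ...   | false = begin
    ∑ allMatrices (χ-restricted T K)
      ≡⟨ ∑-χ-restricted-halve T K simpleT i<j Tij Kij ⟩
    + 2 · ∑ allMatrices (χ-restricted T′ K)
      ≡⟨ cong (+ 2 ·_) (∑-χ-restricted e T′ (Toggled-Simple i≢j t simpleT) ≡e K) ⟩
    + 2 · (+ (2 ^ e) · ⟦ edgeless (K ∩ T′) ⟧)
      ≡⟨ trans (cong (_· ⟦ edgeless (K ∩ T′) ⟧) (ℤₚ.pos-* 2 (2 ^ e))) (ℤₚ.*-assoc (+ 2) (+ (2 ^ e)) _) ⟨
    + (2 ^ suc e) · ⟦ edgeless (K ∩ T′) ⟧
      ≡⟨ cong (λ b → + (2 ^ suc e) · ⟦ b ⟧) (edgeless-cong (K ∩ T′) (K ∩ T) same) ⟩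
    + (2 ^ suc e) · ⟦ edgeless (K ∩ T) ⟧ ∎
    where
      open ≡-Reasoning
      i≢j : i ≢ j
      i≢j = <ᶠ⇒≢ i j i<j
      T′ : Adj n
      T′ = toggle i j T
      t : Toggled i j T T′
      t = toggle-Toggled i j T i≢j
      ≡e : edgeCount T′ ≡ e
      ≡e = ℕₚ.suc-injective (trans (sym (edgeCount-Toggled T T′ i<j Tij t)) ≡suc)
      same : ∀ a b → a <ᶠ b ≡ true → K a b ∧ T′ a b ≡ K a b ∧ T a b
      same a b a<b with cell i j a b
      ... | at-ij refl refl   rewrite Kij = refl
      ... | at-ji refl refl   = ⊥-elim (true≢false a<b (<ᶠ-asym i j i<j))
      ... | elsewhere ¬ij ¬ji = cong (K a b ∧_) (keeps t a b ¬ij ¬ji)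

  ∑-χ-simpleSubgraphs : (T : Adj n) → Simple T → ∀ K →
    ∑[ M ∈ simpleGraphs n ] (⟦ M ⊆ᵇ T ⟧ · χ K M) ≡ + (2 ^ edgeCount T) · ⟦ edgeless (K ∩ T) ⟧
  ∑-χ-simpleSubgraphs T simpleT K = begin
    ∑[ M ∈ simpleGraphs n ] (⟦ M ⊆ᵇ T ⟧ · χ K M)            ≡⟨ ∑-filter isSimple allMatrices _ ⟩
    ∑[ M ∈ allMatrices ] (⟦ isSimple M ⟧ · (⟦ M ⊆ᵇ T ⟧ · χ K M))
      ≡⟨ ∑-cong allMatrices (λ M → trans (sym (ℤₚ.*-assoc ⟦ isSimple M ⟧ ⟦ M ⊆ᵇ T ⟧ (χ K M)))
                                         (cong (_· χ K M) (sym (⟦∧⟧ (isSimple M) (M ⊆ᵇ T))))) ⟩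
    ∑ allMatrices (χ-restricted T K)                        ≡⟨ ∑-χ-restricted _ T simpleT refl K ⟩
    + (2 ^ edgeCount T) · ⟦ edgeless (K ∩ T) ⟧              ∎
    where open ≡-Reasoning

completeOn : ∀ {n} → Sub n → Adj n
completeOn S a b = S a ∧ S b ∧ (a <ᶠ b ∨ b <ᶠ a)

sucC2 : ∀ s → suc s C 2 ≡ s ℕ.+ s C 2
sucC2 s = trans (sym (nCk+nC[k+1]≡[n+1]C[k+1] s 1)) (cong (ℕ._+ s C 2) (nC1≡n s))

C2-nonzero : ∀ {s} → 2 ≤ s → ∃ λ e → s C 2 ≡ suc e
C2-nonzero (s≤s (s≤s {n = s} _)) = _ , sucC2 (suc s)

edgeCount-completeOn : ∀ {n} (S : Sub n) → edgeCount (completeOn S) ≡ size S C 2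
edgeCount-completeOn {n} S = trans (edgeCount≡sumF (completeOn S)) (trans (edges n S) (cong (_C 2) (sym (countᶠ≡countF S))))
  where
    edges : ∀ n (S : Sub n) → sumF n (λ a → countF n (λ b → a <ᶠ b ∧ completeOn S a b)) ≡ countF n S C 2
    edges zero    S = refl
    edges (suc n) S with S zero
    ... | true  = trans (cong₂ ℕ._+_ (countF-cong n (λ b → ∧-identityʳ (S (suc b)))) (edges n (S ∘ suc)))
                        (sym (sucC2 (countF n (S ∘ suc))))
    ... | false = cong₂ ℕ._+_ (false⇒countF≡0 n (λ _ → refl)) (edges n (S ∘ suc))

∑-countF≡ᵇ : ∀ n k → ∑[ S ∈ allFuns n bools ] ⟦ countF n S ≡ᵇ k ⟧ ≡ + (n C k)
∑-countF≡ᵇ zero    zero    = refl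
∑-countF≡ᵇ zero    (suc k) = refl
∑-countF≡ᵇ (suc n) zero    = begin
  ∑[ S ∈ allFuns (suc n) bools ] ⟦ countF (suc n) S ≡ᵇ 0 ⟧
    ≡⟨ ∑-allFuns-suc n bools _ ⟩
  ∑[ S ∈ Sₙ ] (+ 0) + (∑[ S ∈ Sₙ ] ⟦ countF n S ≡ᵇ 0 ⟧ + + 0)
    ≡⟨ cong₂ _+_ (∑-zero Sₙ) (ℤₚ.+-identityʳ (∑[ S ∈ Sₙ ] ⟦ countF n S ≡ᵇ 0 ⟧)) ⟩
  + 0 + ∑[ S ∈ Sₙ ] ⟦ countF n S ≡ᵇ 0 ⟧
    ≡⟨ trans (ℤₚ.+-identityˡ _) (∑-countF≡ᵇ n 0) ⟩
  + 1 ∎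
  where
    open ≡-Reasoning
    Sₙ : List (Sub n)
    Sₙ = allFuns n bools
∑-countF≡ᵇ (suc n) (suc k) = begin
  ∑[ S ∈ allFuns (suc n) bools ] ⟦ countF (suc n) S ≡ᵇ suc k ⟧
    ≡⟨ ∑-allFuns-suc n bools _ ⟩
  ∑[ S ∈ Sₙ ] ⟦ countF n S ≡ᵇ k ⟧ + (∑[ S ∈ Sₙ ] ⟦ countF n S ≡ᵇ suc k ⟧ + + 0)
    ≡⟨ cong₂ _+_ (∑-countF≡ᵇ n k) (trans (ℤₚ.+-identityʳ (∑[ S ∈ Sₙ ] ⟦ countF n S ≡ᵇ suc k ⟧)) (∑-countF≡ᵇ n (suc k))) ⟩
  + (n C k) + + (n C suc k)
    ≡⟨ ℤₚ.pos-+ (n C k) (n C suc k) ⟨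
  + (n C k ℕ.+ n C suc k)
    ≡⟨ cong +_ (nCk+nC[k+1]≡[n+1]C[k+1] n k) ⟩
  + (suc n C suc k) ∎
  where
    open ≡-Reasoning
    Sₙ : List (Sub n)
    Sₙ = allFuns n bools

length-kSubsets : ∀ n k → length (kSubsets n k) ≡ n C k
length-kSubsets n k = ℤₚ.+-injective (begin
  + length (kSubsets n k)                           ≡⟨ length-filter _ (allFuns n bools) ⟩
  ∑[ S ∈ allFuns n bools ] ⟦ size S ≡ᵇ k ⟧          ≡⟨ ∑-cong (allFuns n bools) (λ S → cong (λ s → ⟦ s ≡ᵇ k ⟧) (countᶠ≡countF S)) ⟩
  ∑[ S ∈ allFuns n bools ] ⟦ countF n S ≡ᵇ k ⟧      ≡⟨ ∑-countF≡ᵇ n k ⟩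
  + (n C k)                                         ∎)
  where open ≡-Reasoning

size-kSubsets : ∀ n k (a : Fin (length (kSubsets n k))) → size (lookup (kSubsets n k) a) ≡ k
size-kSubsets n k a = ℕₚ.≡ᵇ⇒≡ _ k (subst T (sym (lookup-filterᵇ (λ S → size S ≡ᵇ k) (allFuns n bools) a)) tt)

module _ {n : ℕ} where

  completeOn-Simple : (S : Sub n) → Simple (completeOn S)
  completeOn-Simple S = record { loopless = loopless′ ; symmetric = λ a b → swap (S a) (S b) (a <ᶠ b) (b <ᶠ a) }
    where
      loopless′ : ∀ a → completeOn S a a ≡ false
      loopless′ a rewrite <ᶠ-irrefl a with S a
      ... | true  = refl
      ... | false = refl
      swap : ∀ x y u v → x ∧ y ∧ (u ∨ v) ≡ y ∧ x ∧ (v ∨ u)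
      swap false false _     _     = refl
      swap false true  _     _     = refl
      swap true  false _     _     = refl
      swap true  true  false false = refl
      swap true  true  false true  = refl
      swap true  true  true  false = refl
      swap true  true  true  true  = refl

  graphOn≡⊆ᵇcompleteOn : (S : Sub n) (H : Adj n) → isSimple H ≡ true → graphOn S H ≡ H ⊆ᵇ completeOn S
  graphOn≡⊆ᵇcompleteOn S H simpleH = ≡true⇔⇒≡
    (λ on → ⊆ᵇ-complete H (completeOn S) (λ a b Hab → inside a b Hab (allᶠ-sound (allᶠ-sound (∧-conicalʳ _ _ on) a) b)))
    (λ H⊆S → ∧-intro simpleH (allᶠ-complete λ a → allᶠ-complete λ b → endpoints a b (⊆ᵇ-sound H (completeOn S) H⊆S a b)))
    where
      inside : ∀ a b → H a b ≡ true → (if H a b then S a ∧ S b else true) ≡ true → completeOn S a b ≡ true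
      inside a b Hab SaSb rewrite Hab with <ᶠ-trichotomy a b
      ... | inj₁ a<b         rewrite a<b = ∧-intro (∧-conicalˡ (S a) _ SaSb) (∧-intro (∧-conicalʳ (S a) _ SaSb) refl)
      ... | inj₂ (inj₁ b<a)  rewrite b<a = ∧-intro (∧-conicalˡ (S a) _ SaSb) (∧-intro (∧-conicalʳ (S a) _ SaSb) (∨-zeroʳ _))
      ... | inj₂ (inj₂ refl) = ⊥-elim (true≢false Hab (loopless (isSimple⇒Simple H simpleH) a))
      endpoints : ∀ a b → (H a b ≡ true → completeOn S a b ≡ true) → (if H a b then S a ∧ S b else true) ≡ true
      endpoints a b H⊆S with H a b in Hab
      ... | false = refl
      ... | true  = let S-ab = H⊆S refl in ∧-intro (∧-conicalˡ (S a) _ S-ab) (∧-conicalˡ (S b) _ (∧-conicalʳ (S a) _ S-ab))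

  edgeless-∩-completeOn : (P Q : Adj n) (S : Sub n) → (∀ a b → not (P a b) ≡ Q a b) →
    edgeless (P ∩ completeOn S) ≡ allᶠ (λ i → allᶠ (λ j → if S i ∧ S j ∧ (i <ᶠ j) then Q i j else true))
  edgeless-∩-completeOn P Q S ¬P≗Q =
    sym (trans (allᶠ≡allF {n} _) (allF-cong n λ a → trans (allᶠ≡allF {n} _) (allF-cong n λ b → entry a b)))
    where
      entry : ∀ a b → (if S a ∧ S b ∧ (a <ᶠ b) then Q a b else true) ≡ (if a <ᶠ b then not (P a b ∧ completeOn S a b) else true)
      entry a b with a <ᶠ b | S a | S b
      ... | false | false | _     = refl
      ... | false | true  | false = refl
      ... | false | true  | true  = refl
      ... | true  | false | _     = sym (cong not (∧-zeroʳ (P a b)))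
      ... | true  | true  | false = sym (cong not (∧-zeroʳ (P a b)))
      ... | true  | true  | true  = sym (trans (cong not (∧-identityʳ (P a b))) (¬P≗Q a b))

  full : Adj n
  full _ _ = true

  isIndepOn≡edgeless : (G : Adj n) (S : Sub n) → isIndepOn G S ≡ edgeless (G ∩ completeOn S)
  isIndepOn≡edgeless G S = sym (edgeless-∩-completeOn G (λ a b → not (G a b)) S (λ _ _ → refl))

  isCliqueOn≡edgeless : (G : Adj n) (S : Sub n) → isCliqueOn G S ≡ edgeless ((full ⊕ G) ∩ completeOn S)
  isCliqueOn≡edgeless G S = sym (edgeless-∩-completeOn (full ⊕ G) G S (λ a b → not-involutive (G a b)))

  isCliqueOn∧isIndepOn : (G : Adj n) (S : Sub n) → 2 ≤ size S → isCliqueOn G S ∧ isIndepOn G S ≡ false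
  isCliqueOn∧isIndepOn G S 2≤|S| rewrite isCliqueOn≡edgeless G S | isIndepOn≡edgeless G S
    with edgeCount≡suc⇒edge (completeOn S) (trans (edgeCount-completeOn S) (proj₂ (C2-nonzero 2≤|S|)))
  ... | i , j , i<j , Sij with edgeless ((full ⊕ G) ∩ completeOn S) in clique | edgeless (G ∩ completeOn S) in indep
  ...   | false | _     = refl
  ...   | true  | false = refl
  ...   | true  | true  = ⊥-elim (true≢false (∧-intro (≡false⇒not ¬Gij) Sij) (edgeless-sound _ clique i j i<j))
    where ¬Gij : G i j ≡ false
          ¬Gij = trans (sym (∧-identityʳ (G i j))) (trans (cong (G i j ∧_) (sym Sij)) (edgeless-sound _ indep i j i<j))

  χ-full : (H : Adj n) → χ full H ≡ -1ℤ ℤ.^ edgeCount H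
  χ-full H = begin
    χ full H                                                   ≡⟨ ∏-cong n (λ a → ∏-sgn n _) ⟩
    ∏[ a < n ] (-1ℤ ℤ.^ countF n (λ b → a <ᶠ b ∧ H a b))      ≡⟨ ∏-pow n -1ℤ _ ⟩
    -1ℤ ℤ.^ sumF n (λ a → countF n (λ b → a <ᶠ b ∧ H a b))    ≡⟨ cong (-1ℤ ℤ.^_) (edgeCount≡sumF H) ⟨
    -1ℤ ℤ.^ edgeCount H                                        ∎
    where open ≡-Reasoning

  ⟦isCliqueOn∨isIndepOn⟧ : (G : Adj n) (S : Sub n) → 2 ≤ size S →
    ⟦ isCliqueOn G S ∨ isIndepOn G S ⟧ ≡ ⟦ edgeless (G ∩ completeOn S) ⟧ + ⟦ edgeless ((full ⊕ G) ∩ completeOn S) ⟧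
  ⟦isCliqueOn∨isIndepOn⟧ G S 2≤|S| = begin
    ⟦ isCliqueOn G S ∨ isIndepOn G S ⟧   ≡⟨ ⟦∨⟧ (isCliqueOn G S) (isIndepOn G S) (isCliqueOn∧isIndepOn G S 2≤|S|) ⟩
    ⟦ isCliqueOn G S ⟧ + ⟦ isIndepOn G S ⟧ ≡⟨ ℤₚ.+-comm ⟦ isCliqueOn G S ⟧ ⟦ isIndepOn G S ⟧ ⟩
    ⟦ isIndepOn G S ⟧ + ⟦ isCliqueOn G S ⟧ ≡⟨ cong₂ (λ x y → ⟦ x ⟧ + ⟦ y ⟧) (isIndepOn≡edgeless G S) (isCliqueOn≡edgeless G S) ⟩
    ⟦ edgeless (G ∩ completeOn S) ⟧ + ⟦ edgeless ((full ⊕ G) ∩ completeOn S) ⟧ ∎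
    where open ≡-Reasoning

  2⟦evenOn⟧·χ : (S : Sub n) (G H : Adj n) → isSimple H ≡ true →
    + 2 · (⟦ graphOn S H ∧ isEven (edgeCount H) ⟧ · χ H G)
      ≡ ⟦ H ⊆ᵇ completeOn S ⟧ · χ G H + ⟦ H ⊆ᵇ completeOn S ⟧ · χ (full ⊕ G) H
  2⟦evenOn⟧·χ S G H simpleH = begin
    + 2 · (⟦ graphOn S H ∧ isEven (edgeCount H) ⟧ · χ H G)
      ≡⟨ cong₂ (λ x y → + 2 · (x · y))
               (trans (⟦∧⟧ (graphOn S H) _) (cong (λ b → ⟦ b ⟧ · _) (graphOn≡⊆ᵇcompleteOn S H simpleH))) (χ-comm H G) ⟩
    + 2 · (⟦ H ⊆ᵇ Kₛ ⟧ · ⟦ isEven (edgeCount H) ⟧ · χ G H)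
      ≡⟨ regroup ⟦ H ⊆ᵇ Kₛ ⟧ _ (χ G H) ⟩
    ⟦ H ⊆ᵇ Kₛ ⟧ · (+ 2 · ⟦ isEven (edgeCount H) ⟧) · χ G H
      ≡⟨ cong (λ x → ⟦ H ⊆ᵇ Kₛ ⟧ · x · χ G H) (trans (2⟦isEven⟧ (edgeCount H)) (cong (_+_ (+ 1)) (sym (χ-full H)))) ⟩
    ⟦ H ⊆ᵇ Kₛ ⟧ · (+ 1 + χ full H) · χ G H
      ≡⟨ expand ⟦ H ⊆ᵇ Kₛ ⟧ (χ full H) (χ G H) ⟩
    ⟦ H ⊆ᵇ Kₛ ⟧ · χ G H + ⟦ H ⊆ᵇ Kₛ ⟧ · (χ full H · χ G H)
      ≡⟨ cong (λ x → ⟦ H ⊆ᵇ Kₛ ⟧ · χ G H + ⟦ H ⊆ᵇ Kₛ ⟧ · x) (χ-⊕ full G H) ⟩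
    ⟦ H ⊆ᵇ Kₛ ⟧ · χ G H + ⟦ H ⊆ᵇ Kₛ ⟧ · χ (full ⊕ G) H ∎
    where
      open ≡-Reasoning
      Kₛ : Adj n
      Kₛ = completeOn S
      regroup : ∀ s v c → + 2 · (s · v · c) ≡ s · (+ 2 · v) · c
      regroup = solve-∀
      expand : ∀ s x c → s · (+ 1 + x) · c ≡ s · c + s · (x · c)
      expand = solve-∀

  ∑-χ-evenGraphsOn : (S : Sub n) → 2 ≤ size S → (G : Adj n) →
    ∑[ H ∈ simpleGraphs n ] (⟦ graphOn S H ∧ isEven (edgeCount H) ⟧ · χ H G)
      ≡ + (2 ^ (size S C 2 ∸ 1)) · ⟦ isCliqueOn G S ∨ isIndepOn G S ⟧
  ∑-χ-evenGraphsOn S 2≤|S| G with C2-nonzero 2≤|S|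
  ... | e , C2≡suc rewrite C2≡suc = ℤₚ.*-cancelˡ-≡ (+ 2) _ _ (begin
    + 2 · ∑[ H ∈ simpleGraphs n ] (⟦ graphOn S H ∧ isEven (edgeCount H) ⟧ · χ H G)
      ≡⟨ ·-distribˡ-∑ (+ 2) (simpleGraphs n) _ ⟩
    ∑[ H ∈ simpleGraphs n ] (+ 2 · (⟦ graphOn S H ∧ isEven (edgeCount H) ⟧ · χ H G))
      ≡⟨ ∑-filter-cong isSimple allMatrices (2⟦evenOn⟧·χ S G) ⟩
    ∑[ H ∈ simpleGraphs n ] (⟦ H ⊆ᵇ Kₛ ⟧ · χ G H + ⟦ H ⊆ᵇ Kₛ ⟧ · χ (full ⊕ G) H)
      ≡⟨ ∑-distrib-+ (simpleGraphs n) _ _ ⟩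
    ∑[ H ∈ simpleGraphs n ] (⟦ H ⊆ᵇ Kₛ ⟧ · χ G H) + ∑[ H ∈ simpleGraphs n ] (⟦ H ⊆ᵇ Kₛ ⟧ · χ (full ⊕ G) H)
      ≡⟨ cong₂ _+_ (∑-χ-simpleSubgraphs Kₛ (completeOn-Simple S) G) (∑-χ-simpleSubgraphs Kₛ (completeOn-Simple S) (full ⊕ G)) ⟩
    + (2 ^ edgeCount Kₛ) · ⟦ edgeless (G ∩ Kₛ) ⟧ + + (2 ^ edgeCount Kₛ) · ⟦ edgeless ((full ⊕ G) ∩ Kₛ) ⟧
      ≡⟨ ℤₚ.*-distribˡ-+ (+ (2 ^ edgeCount Kₛ)) _ _ ⟨
    + (2 ^ edgeCount Kₛ) · (⟦ edgeless (G ∩ Kₛ) ⟧ + ⟦ edgeless ((full ⊕ G) ∩ Kₛ) ⟧)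
      ≡⟨ cong₂ _·_ (cong (λ c → + (2 ^ c)) (trans (edgeCount-completeOn S) C2≡suc)) (sym (⟦isCliqueOn∨isIndepOn⟧ G S 2≤|S|)) ⟩
    + (2 ^ suc e) · ⟦ isCliqueOn G S ∨ isIndepOn G S ⟧
      ≡⟨ trans (cong (_· ⟦ isCliqueOn G S ∨ isIndepOn G S ⟧) (ℤₚ.pos-* 2 (2 ^ e))) (ℤₚ.*-assoc (+ 2) (+ (2 ^ e)) _) ⟩
    + 2 · (+ (2 ^ e) · ⟦ isCliqueOn G S ∨ isIndepOn G S ⟧) ∎)
    where
      open ≡-Reasoning
      Kₛ : Adj n
      Kₛ = completeOn S

  empty : Adj n
  empty _ _ = false

  ∑-edgeless-simpleGraphs : ∑[ H ∈ simpleGraphs n ] ⟦ edgeCount H ≡ᵇ 0 ⟧ ≡ + 1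
  ∑-edgeless-simpleGraphs = begin
    ∑[ H ∈ simpleGraphs n ] ⟦ edgeCount H ≡ᵇ 0 ⟧                ≡⟨ ∑-filter-cong isSimple allMatrices summand ⟩
    ∑[ H ∈ simpleGraphs n ] (⟦ H ⊆ᵇ empty ⟧ · χ empty H)          ≡⟨ ∑-χ-simpleSubgraphs empty emptySimple empty ⟩
    + (2 ^ edgeCount empty) · ⟦ edgeless (empty ∩ empty) ⟧        ≡⟨ cong₂ (λ e b → + (2 ^ e) · ⟦ b ⟧)
                                                                        (Edgeless⇒edgeCount≡0 empty (λ _ _ _ → refl))
                                                                        (edgeless-complete (empty ∩ empty) (λ _ _ _ → refl)) ⟩
    + 1                                                           ∎
    where
      open ≡-Reasoning
      emptySimple : Simple empty
      emptySimple = record { loopless = λ _ → refl ; symmetric = λ _ _ → refl }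
      summand : ∀ H → isSimple H ≡ true → ⟦ edgeCount H ≡ᵇ 0 ⟧ ≡ ⟦ H ⊆ᵇ empty ⟧ · χ empty H
      summand H simpleH = sym (trans (cong (⟦ H ⊆ᵇ empty ⟧ ·_) (χ-disjoint empty H (λ _ _ _ → refl)))
                                     (trans (ℤₚ.*-identityʳ _) (cong ⟦_⟧ (≡true⇔⇒≡ to from))))
        where
          to : H ⊆ᵇ empty ≡ true → (edgeCount H ≡ᵇ 0) ≡ true
          to H⊆∅ = cong (_≡ᵇ 0) (Edgeless⇒edgeCount≡0 H λ a b _ → H≡false a b)
            where H≡false : ∀ a b → H a b ≡ false
                  H≡false a b with H a b in Hab
                  ... | false = refl
                  ... | true  = ⊥-elim (true≢false (⊆ᵇ-sound H empty H⊆∅ a b Hab) refl)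
          from : (edgeCount H ≡ᵇ 0) ≡ true → H ⊆ᵇ empty ≡ true
          from ≡0 = ⊆ᵇ-complete H empty λ a b Hab → ⊥-elim (true≢false Hab
                      (Simple-Edgeless⇒≡false H (isSimple⇒Simple H simpleH) (edgeCount≡0⇒Edgeless H (≡ᵇ0⇒≡0 ≡0)) a b))

  ∑-χ-edgelessGraphsOn : (S : Sub n) (G : Adj n) →
    ∑[ H ∈ simpleGraphs n ] (⟦ graphOn S H ∧ isEven (edgeCount H) ⟧ · ⟦ edgeCount H ≡ᵇ 0 ⟧ · χ H G) ≡ + 1
  ∑-χ-edgelessGraphsOn S G = trans (∑-filter-cong isSimple allMatrices summand) ∑-edgeless-simpleGraphs
    where
      summand : ∀ H → isSimple H ≡ true →
                ⟦ graphOn S H ∧ isEven (edgeCount H) ⟧ · ⟦ edgeCount H ≡ᵇ 0 ⟧ · χ H G ≡ ⟦ edgeCount H ≡ᵇ 0 ⟧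
      summand H simpleH with edgeCount H ≡ᵇ 0 in ≡0
      ... | false = trans (cong (_· χ H G) (ℤₚ.*-zeroʳ ⟦ graphOn S H ∧ _ ⟧)) (ℤₚ.*-zeroˡ (χ H G))
      ... | true  = cong₂ (λ b x → ⟦ b ⟧ · + 1 · x) evenOn (χ-disjoint H G λ a b _ → cong (_∧ G a b) (H≡false a b))
        where
          H≡false : ∀ a b → H a b ≡ false
          H≡false = Simple-Edgeless⇒≡false H (isSimple⇒Simple H simpleH) (edgeCount≡0⇒Edgeless H (≡ᵇ0⇒≡0 ≡0))
          evenOn : graphOn S H ∧ isEven (edgeCount H) ≡ true
          evenOn = ∧-intro (trans (graphOn≡⊆ᵇcompleteOn S H simpleH)
                                  (⊆ᵇ-complete H _ λ a b Hab → ⊥-elim (true≢false Hab (H≡false a b))))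
                           (cong isEven (≡ᵇ0⇒≡0 {edgeCount H} ≡0))

  weight : ℤ → Sub n → Adj n → ℤ
  weight c S H = ⟦ graphOn S H ∧ isEven (edgeCount H) ⟧ · (c · ⟦ edgeCount H ≡ᵇ 0 ⟧ - + 1)

  ∑-weight-χ : ∀ {k} (S : Sub n) → size S ≡ k → 2 ≤ k → (G : Adj n) →
    let c = + (2 ^ (k C 2 ∸ 1)) in
    ∑[ H ∈ simpleGraphs n ] (weight c S H · χ H G) ≡ c · (+ 1 - ⟦ isCliqueOn G S ∨ isIndepOn G S ⟧)
  ∑-weight-χ S refl 2≤|S| G = begin
    ∑[ H ∈ simpleGraphs n ] (weight c S H · χ H G)
      ≡⟨ ∑-cong (simpleGraphs n) (λ H → distribute ⟦ evenOn H ⟧ c ⟦ edgeCount H ≡ᵇ 0 ⟧ (χ H G)) ⟩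
    ∑[ H ∈ simpleGraphs n ] (c · (⟦ evenOn H ⟧ · ⟦ edgeCount H ≡ᵇ 0 ⟧ · χ H G) - ⟦ evenOn H ⟧ · χ H G)
      ≡⟨ ∑-distrib-- (simpleGraphs n) _ _ ⟩
    ∑[ H ∈ simpleGraphs n ] (c · (⟦ evenOn H ⟧ · ⟦ edgeCount H ≡ᵇ 0 ⟧ · χ H G)) - ∑[ H ∈ simpleGraphs n ] (⟦ evenOn H ⟧ · χ H G)
      ≡⟨ cong₂ _-_ (trans (sym (·-distribˡ-∑ c (simpleGraphs n) _)) (cong (c ·_) (∑-χ-edgelessGraphsOn S G)))
                   (∑-χ-evenGraphsOn S 2≤|S| G) ⟩
    c · + 1 - c · ⟦ isCliqueOn G S ∨ isIndepOn G S ⟧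
      ≡⟨ factor c _ ⟩
    c · (+ 1 - ⟦ isCliqueOn G S ∨ isIndepOn G S ⟧) ∎
    where
      open ≡-Reasoning
      c : ℤ
      c = + (2 ^ (size S C 2 ∸ 1))
      evenOn : Adj n → Bool
      evenOn H = graphOn S H ∧ isEven (edgeCount H)
      distribute : ∀ e c z x → e · (c · z - + 1) · x ≡ c · (e · z · x) - e · x
      distribute = solve-∀
      factor : ∀ c m → c · + 1 - c · m ≡ c · (+ 1 - m)
      factor = solve-∀

  ∑-χ : (K : Adj n) → ∑[ G ∈ simpleGraphs n ] χ K G ≡ + (2 ^ (n C 2)) · ⟦ edgeless K ⟧
  ∑-χ K = begin
    ∑[ G ∈ simpleGraphs n ] χ K G                        ≡⟨ ∑-filter-cong isSimple allMatrices (λ G simpleG → sym (in-Kₙ G simpleG)) ⟩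
    ∑[ G ∈ simpleGraphs n ] (⟦ G ⊆ᵇ Kₙ ⟧ · χ K G)         ≡⟨ ∑-χ-simpleSubgraphs Kₙ (completeOn-Simple (λ _ → true)) K ⟩
    + (2 ^ edgeCount Kₙ) · ⟦ edgeless (K ∩ Kₙ) ⟧         ≡⟨ cong₂ (λ e b → + (2 ^ e) · ⟦ b ⟧) |Kₙ| (edgeless-cong (K ∩ Kₙ) K K∩Kₙ≗K) ⟩
    + (2 ^ (n C 2)) · ⟦ edgeless K ⟧                     ∎
    where
      open ≡-Reasoning
      Kₙ : Adj n
      Kₙ = completeOn {n} (λ _ → true)
      |Kₙ| : edgeCount Kₙ ≡ n C 2
      |Kₙ| = trans (edgeCount-completeOn {n} (λ _ → true)) (cong (_C 2) (trans (countᶠ≡countF {n} (λ _ → true)) (count-true n)))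
        where count-true : ∀ m → countF m (λ _ → true) ≡ m
              count-true zero    = refl
              count-true (suc m) = cong suc (count-true m)
      in-Kₙ : ∀ G → isSimple G ≡ true → ⟦ G ⊆ᵇ Kₙ ⟧ · χ K G ≡ χ K G
      in-Kₙ G simpleG = trans (cong (λ b → ⟦ b ⟧ · χ K G) (⊆ᵇ-complete G Kₙ G⊆Kₙ)) (ℤₚ.*-identityˡ (χ K G))
        where G⊆Kₙ : G ⊆ Kₙ
              G⊆Kₙ a b Gab with <ᶠ-trichotomy a b
              ... | inj₁ a<b         rewrite a<b = refl
              ... | inj₂ (inj₁ b<a)  rewrite b<a = ∨-zeroʳ (a <ᶠ b)
              ... | inj₂ (inj₂ refl) = ⊥-elim (true≢false Gab (loopless (isSimple⇒Simple G simpleG) a))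
      K∩Kₙ≗K : ∀ a b → a <ᶠ b ≡ true → K a b ∧ Kₙ a b ≡ K a b
      K∩Kₙ≗K a b a<b rewrite a<b = ∧-identityʳ (K a b)

  χ-shift : (K : Adj n) (f : Adj n → ℤ) (G : Adj n) →
            χ K G · ∑[ H ∈ simpleGraphs n ] (f H · χ H G) ≡ ∑[ H ∈ simpleGraphs n ] (f H · χ (K ⊕ H) G)
  χ-shift K f G = trans (·-distribˡ-∑ (χ K G) (simpleGraphs n) _) (∑-cong (simpleGraphs n) λ H →
    trans (x∙yz≈y∙xz (χ K G) (f H) (χ H G)) (cong (f H ·_) (χ-⊕ K H G)))

  ⨁ : ∀ {N} → (Fin N → Adj n) → Adj n
  ⨁ {N} h i j = xorF N (λ a → h a i j)

  ⨁-∷ᶠ : ∀ {N} (f : Fin (suc N) → Adj n → ℤ) (K H : Adj n) (h : Fin N → Adj n) →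
         f zero H · (⟦ edgeless ((K ⊕ H) ⊕ ⨁ h) ⟧ · ∏[ a < N ] f (suc a) (h a))
           ≡ ⟦ edgeless (K ⊕ ⨁ (H ∷ᶠ h)) ⟧ · ∏[ a < suc N ] f a ((H ∷ᶠ h) a)
  ⨁-∷ᶠ {N} f K H h = trans (x∙yz≈y∙xz (f zero H) ⟦ edgeless ((K ⊕ H) ⊕ ⨁ h) ⟧ (∏[ a < N ] f (suc a) (h a)))
    (cong (λ b → ⟦ b ⟧ · (f zero H · ∏[ a < N ] f (suc a) (h a))) (edgeless-cong _ _ λ i j _ → xor-assoc (K i j) (H i j) _))

  ∑-χ-∏ : ∀ N (f : Fin N → Adj n → ℤ) (K : Adj n) →
    ∑[ G ∈ simpleGraphs n ] (χ K G · ∏[ a < N ] ∑[ H ∈ simpleGraphs n ] (f a H · χ H G))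
      ≡ + (2 ^ (n C 2)) · ∑[ h ∈ allFuns N (simpleGraphs n) ] (⟦ edgeless (K ⊕ ⨁ h) ⟧ · ∏[ a < N ] f a (h a))
  ∑-χ-∏ zero f K = begin
    ∑[ G ∈ simpleGraphs n ] (χ K G · + 1)      ≡⟨ ∑-cong (simpleGraphs n) (λ G → ℤₚ.*-identityʳ (χ K G)) ⟩
    ∑[ G ∈ simpleGraphs n ] χ K G              ≡⟨ ∑-χ K ⟩
    + (2 ^ (n C 2)) · ⟦ edgeless K ⟧           ≡⟨ cong (λ x → + (2 ^ (n C 2)) · x) (sym (trans (ℤₚ.+-identityʳ _) (trans (ℤₚ.*-identityʳ _)
                                                    (cong ⟦_⟧ (edgeless-cong _ K (λ a b _ → xor-identityʳ (K a b))))))) ⟩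
    + (2 ^ (n C 2)) · (⟦ edgeless (K ⊕ ⨁ {0} (λ ())) ⟧ · + 1 + + 0) ∎
    where open ≡-Reasoning
  ∑-χ-∏ (suc N) f K = begin
    ∑[ G ∈ SG ] (χ K G · (∑[ H ∈ SG ] (f zero H · χ H G) · R G))
      ≡⟨ ∑-cong SG (λ G → trans (sym (ℤₚ.*-assoc (χ K G) _ (R G))) (cong (_· R G) (χ-shift K (f zero) G))) ⟩
    ∑[ G ∈ SG ] (∑[ H ∈ SG ] (f zero H · χ (K ⊕ H) G) · R G)
      ≡⟨ ∑-cong SG (λ G → trans (·-distribʳ-∑ (R G) SG _) (∑-cong SG λ H → ℤₚ.*-assoc (f zero H) _ (R G))) ⟩
    ∑[ G ∈ SG ] ∑[ H ∈ SG ] (f zero H · (χ (K ⊕ H) G · R G))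
      ≡⟨ ∑-comm SG SG _ ⟩
    ∑[ H ∈ SG ] ∑[ G ∈ SG ] (f zero H · (χ (K ⊕ H) G · R G))
      ≡⟨ ∑-cong SG (λ H → trans (sym (·-distribˡ-∑ (f zero H) SG _)) (cong (f zero H ·_) (∑-χ-∏ N (f ∘ suc) (K ⊕ H)))) ⟩
    ∑[ H ∈ SG ] (f zero H · (P · ∑[ h ∈ allFuns N SG ] (⟦ edgeless ((K ⊕ H) ⊕ ⨁ h) ⟧ · ∏[ a < N ] f (suc a) (h a))))
      ≡⟨ ∑-cong SG (λ H → trans (x∙yz≈y∙xz (f zero H) P _) (cong (P ·_) (trans (·-distribˡ-∑ (f zero H) (allFuns N SG) _)
                                                                           (∑-cong (allFuns N SG) (⨁-∷ᶠ f K H))))) ⟩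
    ∑[ H ∈ SG ] (P · ∑[ h ∈ allFuns N SG ] (⟦ edgeless (K ⊕ ⨁ (H ∷ᶠ h)) ⟧ · ∏[ a < suc N ] f a ((H ∷ᶠ h) a)))
      ≡⟨ trans (sym (·-distribˡ-∑ P SG _)) (cong (P ·_) (sym (∑-allFuns-suc N SG _))) ⟩
    P · ∑[ h ∈ allFuns (suc N) SG ] (⟦ edgeless (K ⊕ ⨁ h) ⟧ · ∏[ a < suc N ] f a (h a)) ∎
    where
      open ≡-Reasoning
      SG : List (Adj n)
      SG = simpleGraphs n
      P : ℤ
      P = + (2 ^ (n C 2))
      R : Adj n → ℤ
      R G = ∏[ a < N ] ∑[ H ∈ SG ] (f (suc a) H · χ H G)

module _ (n k : ℕ) (2≤k : 2 ≤ k) where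

  private
    N : ℕ
    N = length (kSubsets n k)
    S : Fin N → Sub n
    S = lookup (kSubsets n k)
    c : ℤ
    c = + (2 ^ (k C 2 ∸ 1))

  ramsey-expansion : (G : Adj n) →
    c ℤ.^ N · ⟦ isRamsey k G ⟧ ≡ ∏[ a < N ] ∑[ H ∈ simpleGraphs n ] (weight c (S a) H · χ H G)
  ramsey-expansion G = begin
    c ℤ.^ N · ⟦ isRamsey k G ⟧
      ≡⟨ cong₂ _·_ (sym (∏-const N c)) (⟦not-or⟧ _ (kSubsets n k)) ⟩
    ∏[ a < N ] c · ∏[ a < N ] (+ 1 - ⟦ isCliqueOn G (S a) ∨ isIndepOn G (S a) ⟧)
      ≡⟨ ∏-distrib-· N _ _ ⟩
    ∏[ a < N ] (c · (+ 1 - ⟦ isCliqueOn G (S a) ∨ isIndepOn G (S a) ⟧))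
      ≡⟨ ∏-cong N (λ a → ∑-weight-χ (S a) (size-kSubsets n k a) 2≤k G) ⟨
    ∏[ a < N ] ∑[ H ∈ simpleGraphs n ] (weight c (S a) H · χ H G) ∎
    where open ≡-Reasoning

  inB≡ : (h : Assignment n k) →
    inB n k h ≡ allF N (λ a → graphOn (S a) (h a) ∧ isEven (edgeCount (h a))) ∧ edgeless (empty ⊕ ⨁ h)
  inB≡ h = begin
    inB n k h
      ≡⟨ cong₂ _∧_ (allᶠ≡allF {N} _) (cong₂ _∧_ (allᶠ≡allF {N} _)
           (trans (allᶠ≡allF {n} _) (allF-cong n λ i → trans (allᶠ≡allF {n} _) (allF-cong n (parity i))))) ⟩
    allF N (λ a → graphOn (S a) (h a)) ∧ allF N (λ a → isEven (edgeCount (h a))) ∧ edgeless (empty ⊕ ⨁ h)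
      ≡⟨ ∧-assoc (allF N (λ a → graphOn (S a) (h a))) _ (edgeless (empty ⊕ ⨁ h)) ⟨
    (allF N (λ a → graphOn (S a) (h a)) ∧ allF N (λ a → isEven (edgeCount (h a)))) ∧ edgeless (empty ⊕ ⨁ h)
      ≡⟨ cong (_∧ edgeless (empty ⊕ ⨁ h)) (allF-∧ N _ _) ⟨
    allF N (λ a → graphOn (S a) (h a) ∧ isEven (edgeCount (h a))) ∧ edgeless (empty ⊕ ⨁ h) ∎
    where
      open ≡-Reasoning
      parity : ∀ i j → (if i <ᶠ j then isEven (countᶠ (λ a → h a i j)) else true)
                     ≡ (if i <ᶠ j then not (⨁ h i j) else true)
      parity i j with i <ᶠ j
      ... | true  = trans (cong isEven (countᶠ≡countF (λ a → h a i j))) (isEven-countF N (λ a → h a i j))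
      ... | false = refl

  ∏-weight : (h : Assignment n k) →
    ⟦ edgeless (empty ⊕ ⨁ h) ⟧ · ∏[ a < N ] weight c (S a) (h a)
      ≡ ⟦ inB n k h ⟧ · ∏[ a < N ] (c · ⟦ edgeCount (h a) ≡ᵇ 0 ⟧ - + 1)
  ∏-weight h = begin
    ⟦ edgeless (empty ⊕ ⨁ h) ⟧ · ∏[ a < N ] weight c (S a) (h a)
      ≡⟨ cong (⟦ edgeless (empty ⊕ ⨁ h) ⟧ ·_) (trans (cong (_· W) (⟦allF⟧ N evenOn)) (∏-distrib-· N _ _)) ⟨
    ⟦ edgeless (empty ⊕ ⨁ h) ⟧ · (⟦ allF N evenOn ⟧ · W)
      ≡⟨ x∙yz≈yx∙z ⟦ edgeless (empty ⊕ ⨁ h) ⟧ ⟦ allF N evenOn ⟧ W ⟩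
    ⟦ allF N evenOn ⟧ · ⟦ edgeless (empty ⊕ ⨁ h) ⟧ · W
      ≡⟨ cong (_· W) (⟦∧⟧ (allF N evenOn) _) ⟨
    ⟦ allF N evenOn ∧ edgeless (empty ⊕ ⨁ h) ⟧ · W
      ≡⟨ cong (λ b → ⟦ b ⟧ · W) (inB≡ h) ⟨
    ⟦ inB n k h ⟧ · W ∎
    where
      open ≡-Reasoning
      W : ℤ
      W = ∏[ a < N ] (c · ⟦ edgeCount (h a) ≡ᵇ 0 ⟧ - + 1)
      evenOn : Fin N → Bool
      evenOn a = graphOn (S a) (h a) ∧ isEven (edgeCount (h a))

  ramsey-count : c ℤ.^ N · + length (filterᵇ (isRamsey k) (simpleGraphs n))
                   ≡ + (2 ^ (n C 2)) · (-1ℤ ℤ.^ N · Q n k (+ 1 - c))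
  ramsey-count = begin
    c ℤ.^ N · + length (filterᵇ (isRamsey k) SG)
      ≡⟨ cong (c ℤ.^ N ·_) (length-filter (isRamsey k) SG) ⟩
    c ℤ.^ N · ∑[ G ∈ SG ] ⟦ isRamsey k G ⟧
      ≡⟨ ·-distribˡ-∑ (c ℤ.^ N) SG _ ⟩
    ∑[ G ∈ SG ] (c ℤ.^ N · ⟦ isRamsey k G ⟧)
      ≡⟨ ∑-cong SG (λ G → trans (ramsey-expansion G)
                          (sym (trans (cong (_· R G) (χ-disjoint empty G λ _ _ _ → refl)) (ℤₚ.*-identityˡ (R G))))) ⟩
    ∑[ G ∈ SG ] (χ empty G · ∏[ a < N ] ∑[ H ∈ SG ] (weight c (S a) H · χ H G))
      ≡⟨ ∑-χ-∏ N (λ a → weight c (S a)) empty ⟩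
    P · ∑[ h ∈ allFuns N SG ] (⟦ edgeless (empty ⊕ ⨁ h) ⟧ · ∏[ a < N ] weight c (S a) (h a))
      ≡⟨ cong (P ·_) (∑-cong (allFuns N SG) ∏-weight) ⟩
    P · ∑[ h ∈ allFuns N SG ] (⟦ inB n k h ⟧ · W h)
      ≡⟨ cong (P ·_) (∑-filter (inB n k) (allFuns N SG) W) ⟨
    P · ∑[ h ∈ 𝓑 n k ] W h
      ≡⟨ cong (P ·_) (∑-cong (𝓑 n k) λ h → trans (∏-c·⟦p⟧-1 N c _)
           (cong (λ e → -1ℤ ℤ.^ N · (+ 1 - c) ℤ.^ e) (sym (countᶠ≡countF {N} (λ a → edgeCount (h a) ≡ᵇ 0))))) ⟩
    P · ∑[ h ∈ 𝓑 n k ] (-1ℤ ℤ.^ N · (+ 1 - c) ℤ.^ emptyCount h)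
      ≡⟨ cong (P ·_) (trans (sym (·-distribˡ-∑ (-1ℤ ℤ.^ N) (𝓑 n k) _))
                            (cong (-1ℤ ℤ.^ N ·_) (sym (foldr-map≡∑ _ (𝓑 n k))))) ⟩
    P · (-1ℤ ℤ.^ N · Q n k (+ 1 - c)) ∎
    where
      open ≡-Reasoning
      SG : List (Adj n)
      SG = simpleGraphs n
      P : ℤ
      P = + (2 ^ (n C 2))
      R : Adj n → ℤ
      R G = ∏[ a < N ] ∑[ H ∈ SG ] (weight c (S a) H · χ H G)
      W : Assignment n k → ℤ
      W h = ∏[ a < N ] (c · ⟦ edgeCount (h a) ≡ᵇ 0 ⟧ - + 1)

ramsey-identity : ∀ n k → 2 ≤ k →
  + (2 ^ ((k C 2 ∸ 1) * (n C k))) · + length (filterᵇ (isRamsey k) (simpleGraphs n))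
    ≡ + (2 ^ (n C 2)) · (-1ℤ ℤ.^ (n C k) · Q n k (+ 1 - + (2 ^ (k C 2 ∸ 1))))
ramsey-identity n k 2≤k = subst (λ N → + (2 ^ (e * N)) · #ramsey ≡ + (2 ^ (n C 2)) · (-1ℤ ℤ.^ N · Q n k (+ 1 - c)))
  (length-kSubsets n k)
  (trans (cong (_· #ramsey) (trans (cong +_ (sym (ℕₚ.^-*-assoc 2 e N))) (sym (+-^ (2 ^ e) N)))) (ramsey-count n k 2≤k))
  where e : ℕ
        e = k C 2 ∸ 1
        c : ℤ
        c = + (2 ^ e)
        N : ℕ
        N = length (kSubsets n k)
        #ramsey : ℤ
        #ramsey = + length (filterᵇ (isRamsey k) (simpleGraphs n))

theorem2p5 : (n k : ℕ) → 2 ≤ k → k ≤ n →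
    ramseyProb n k ≡
    ((ℤ.- (+ 1)) ℤ.^ (n C k)) ℚ./ 1
    ℚ.* ℚ._/_ (+ 1) (2 ^ (((k C 2) ∸ 1) * (n C k))) ⦃ m^n≢0 2 (((k C 2) ∸ 1) * (n C k)) ⦄
    ℚ.* (Q n k ((+ 1) ℤ.- (+ (2 ^ ((k C 2) ∸ 1)))) ℚ./ 1)
theorem2p5 n k 2≤k _ =
  /-from-cross-multiplication _ (-1ℤ ℤ.^ (n C k)) (Q n k (+ 1 - + (2 ^ (k C 2 ∸ 1)))) (2 ^ ((k C 2 ∸ 1) * (n C k))) (2 ^ (n C 2))
    ⦃ m^n≢0 2 ((k C 2 ∸ 1) * (n C k)) ⦄ ⦃ m^n≢0 2 (n C 2) ⦄ (ramsey-identity n k 2≤k)
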